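{- For all integers $k\geq1$ and $n\geq0$, $$nov_k(n)=\frac{k}{2}\,\overline{M[k]}_2(n),$$ where $nov_k(n)$ is the sum, over all overpartitions $\lambda$ of $n$, of all non-overlined parts of $\lambda$ that are divisible by $k$ (each occurrence counted), and $\overline{M[k]}_2(n)$ is the coefficient of $q^n$ in $\left.\delta_z^{2}\overline{C[k]}(z;q)\right|_{z=1}$.
   Context: An overpartition of $n$ is a non-increasing sequence of positive integers summing to $n$ in which the first occurrence of each distinct integer may be overlined. Notation: $(a_1,\dots,a_r;q)_\infty=\prod_{i\geq 0}(1-a_1q^i)\cdots(1-a_rq^i)$, $\delta_z=z\frac{d}{dz}$. For $k\geq1$, $$\overline{C[k]}(z;q)=\frac{(-q;q)_\infty\,(q^k;q^k)_\infty}{(q;q)_\infty}\cdot\frac{(q^k;q^k)_\infty}{(zq^k,q^k/z;q^k)_\infty}=\sum_{n\ge0}\sum_{m\in\mathbb{Z}}\overline{M[k]}(m,n)z^mq^n,$$ so that $\overline{M[k]}_2(n)=\sum_{m}m^2\,\overline{M[k]}(m,n)$ is the second moment of the $k$th residual crank of overpartitions of $n$. -}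

module Defs where

open import Data.Bool using (Bool; true; false; not; _∧_; if_then_else_)
open import Data.Nat as ℕ using (ℕ; zero; suc; _≡ᵇ_; _≤ᵇ_)
open import Data.Nat.Divisibility using (_∣?_)
open import Data.Integer as ℤ using (ℤ; +_; -_)
open import Data.List using (List; []; _∷_; _++_; map; concatMap; concat; foldr; upTo; applyUpTo; filterᵇ)
open import Data.Product using (_×_; _,_; proj₁; proj₂)
open import Relation.Nullary using (does)

-- A part: (value , overlined?)
Part : Set
Part = ℕ × Bool

listsOfLength : {A : Set} → ℕ → List A → List (List A)
listsOfLength zero    xs = [] ∷ []
listsOfLength (suc L) xs = concatMap (λ x → map (x ∷_) (listsOfLength L xs)) xs

sumℕ : List ℕ → ℕ
sumℕ = foldr ℕ._+_ 0

candidateParts : ℕ → List Part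
candidateParts n = concatMap (λ v → (suc v , false) ∷ (suc v , true) ∷ []) (upTo n)

candidates : ℕ → List (List Part)
candidates n = concatMap (λ L → listsOfLength L (candidateParts n)) (upTo (suc n))

allPositive : List Part → Bool
allPositive [] = true
allPositive ((v , _) ∷ ps) = (1 ≤ᵇ v) ∧ allPositive ps

-- non-increasing, and only the first occurrence of a value may be overlined
-- (in a non-increasing list: a part equal to its predecessor is not overlined)
wellOrdered : List Part → Bool
wellOrdered [] = true
wellOrdered (_ ∷ []) = true
wellOrdered ((v , _) ∷ (w , o) ∷ ps) =
  (w ≤ᵇ v) ∧ (if w ≡ᵇ v then not o else true) ∧ wellOrdered ((w , o) ∷ ps)

isOverpartitionOf : ℕ → List Part → Bool
isOverpartitionOf n λ' = allPositive λ' ∧ wellOrdered λ' ∧ (sumℕ (map proj₁ λ') ≡ᵇ n)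

overpartitions : ℕ → List (List Part)
overpartitions n = filterᵇ (isOverpartitionOf n) (candidates n)

novParts : ℕ → List Part → ℕ
novParts k [] = 0
novParts k ((v , o) ∷ ps) =
  (if not o ∧ does (k ∣? v) then v else 0) ℕ.+ novParts k ps

nov : ℕ → ℕ → ℕ
nov k n = sumℕ (map (novParts k) (overpartitions n))

-- Laurent polynomials in z over ℤ, as formal sums of terms (exponent , coeff)

LP : Set
LP = List (ℤ × ℤ)

lpOne : LP
lpOne = (+ 0 , + 1) ∷ []

lpMul : LP → LP → LP
lpMul p r = concatMap (λ t → map (λ s → (proj₁ t ℤ.+ proj₁ s , proj₂ t ℤ.* proj₂ s)) r) p

-- δ_z = z d/dz :  z^e ↦ e z^e
δz : LP → LP
δz = map (λ t → (proj₁ t , proj₁ t ℤ.* proj₂ t))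

evalAt1 : LP → ℤ
evalAt1 = foldr (λ t acc → proj₂ t ℤ.+ acc) (+ 0)

coeffZ : ℤ → LP → ℤ
coeffZ m = foldr (λ t acc → (if does (proj₁ t ℤ.≟ m) then proj₂ t else + 0) ℤ.+ acc) (+ 0)

-- Formal power series in q with coefficients in LP: n ↦ coefficient of q^n

Series : Set
Series = ℕ → LP

sOne : Series
sOne zero    = lpOne
sOne (suc _) = []

sMul : Series → Series → Series
sMul f g n = concatMap (λ i → lpMul (f i) (g (n ℕ.∸ i))) (upTo (suc n))

-- finite sum of monomials c z^e q^d, given as triples (e , c , d)
poly : List (ℤ × ℤ × ℕ) → Series
poly ts n = concatMap (λ t → if proj₂ (proj₂ t) ≡ᵇ n then (proj₁ t , proj₁ (proj₂ t)) ∷ [] else []) ts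

-- 1 / (1 - z^a q^d) = Σ_{t≥0} z^{a t} q^{d t}   (used only with d ≥ 1)
geom : ℤ → ℕ → Series
geom a d n = concatMap (λ t → if (t ℕ.* d) ≡ᵇ n then (a ℤ.* + t , + 1) ∷ [] else []) (upTo (suc n))

prodTo : ℕ → (ℕ → Series) → Series
prodTo zero    F = sOne
prodTo (suc N) F = sMul (prodTo N F) (F (suc N))

-- infinite product ∏_{j≥1} F j, for factors with F j = 1 + O(q^j):
-- the coefficient of q^n only involves the factors j ≤ n.
infProd : (ℕ → Series) → Series
infProd F n = prodTo n F n

-- The residual crank generating function  \overline{C[k]}(z;q)
--  = (-q;q)∞ (q^k;q^k)∞ / (q;q)∞ · (q^k;q^k)∞ / (zq^k, q^k/z; q^k)∞
-- written as ∏_{j≥1} of the j-th factors of each product.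

crankFactor : ℕ → ℕ → Series
crankFactor k j =
  sMul (poly ((+ 0 , + 1 , 0) ∷ (+ 0 , + 1 , j) ∷ []))
  (sMul (geom (+ 0) j)
  (sMul (poly ((+ 0 , + 1 , 0) ∷ (+ 0 , - + 1 , k ℕ.* j) ∷ []))
  (sMul (poly ((+ 0 , + 1 , 0) ∷ (+ 0 , - + 1 , k ℕ.* j) ∷ []))
  (sMul (geom (+ 1) (k ℕ.* j))
        (geom (- + 1) (k ℕ.* j))))))

Cbar : ℕ → Series
Cbar k = infProd (crankFactor k)

Mbar : ℕ → ℤ → ℕ → ℤ
Mbar k m n = coeffZ m (Cbar k n)

M2bar : ℕ → ℕ → ℤ
M2bar k n = evalAt1 (δz (δz (Cbar k n)))

{-# OPTIONS --safe #-}
module Submission where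

-- Write P = ∏_j P_j, P_j = (1 + q^j)/(1 - q^j), for the generating function of overpartitions, and
-- τ_d = Σ_t t q^(dt) = q^d/(1 - q^d)².
--
-- The j-th factor of C̄[k](z;q) is P_j · (1 - q^(kj))² / ((1 - z q^(kj))(1 - q^(kj)/z)).  At z = 1 the
-- triple (f, δ_z f, δ_z² f) of its second part is (1, 0, 2τ_(kj)); such triples multiply by the Leibniz
-- rule, so M̄[k]₂ = 2 P Σ_j τ_(kj).
--
-- Splitting an overpartition at its largest part gives recursions for the number and the nov-weight of
-- the overpartitions whose parts may follow a given part.  The closed forms built from P satisfy the
-- same recursions, which determine their solutions; hence nov_k = P Σ_(k ∣ d) d q^d/(1 - q^d).
-- Both Σ_(k ∣ d) d q^d/(1 - q^d) and k Σ_j τ_(kj) have as coefficient of q^n the sum of the divisors d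
-- of n with k ∣ d, which gives 2 nov_k(n) = k M̄[k]₂(n).

open import Defs
open import Data.Nat using (ℕ; _≤_)
open import Data.Integer using (ℤ; +_; _*_)
open import Relation.Binary.PropositionalEquality using (_≡_)

open import Algebra.Bundles using (CommutativeRing)
import Algebra.Solver.Ring as RingSolver
open import Algebra.Solver.Ring.AlmostCommutativeRing using (fromCommutativeRing; _-Raw-AlmostCommutative⟶_)
open import Data.Bool using (Bool; true; false; T; not; _∧_; if_then_else_)
import Data.Bool.Properties as Boolₚ
open import Data.Empty using (⊥-elim)
open import Data.Integer using (_+_; -_; _-_; 0ℤ; 1ℤ; +-*-rawRing)
import Data.Integer.Properties as ℤₚ
open import Data.Integer.Tactic.RingSolver using (solve-∀)
open import Data.List using (List; []; _∷_; _++_; map; concatMap; applyUpTo; upTo; filterᵇ)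
open import Data.Maybe using (Maybe; just; nothing)
open import Data.Nat as ℕ using (zero; suc; _<_; _≡ᵇ_; _≤ᵇ_; _∸_; s≤s; z≤n)
open import Data.Nat.Divisibility
  using (_∣_; divides; _∣?_; >⇒∤; ∣m+n∣m⇒∣n; ∣-refl; ∣-trans; n∣m*n; *-cancelʳ-∣)
import Data.Nat.Properties as ℕₚ
open import Data.Product using (_×_; _,_; proj₁; proj₂)
open import Function using (_∘_)
open import Relation.Binary.PropositionalEquality
  using (refl; sym; trans; cong; cong₂; subst; _≢_; module ≡-Reasoning)
open import Relation.Nullary using (¬_; yes; no; does)

𝕀 : Bool → ℤ
𝕀 b = if b then 1ℤ else 0ℤ

𝕀-true : ∀ {b} → T b → 𝕀 b ≡ 1ℤ
𝕀-true {true} _ = refl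

𝕀-false : ∀ {b} → ¬ T b → 𝕀 b ≡ 0ℤ
𝕀-false {true}  ¬b = ⊥-elim (¬b _)
𝕀-false {false} _  = refl

𝕀-∧ : ∀ a b → 𝕀 (a ∧ b) ≡ 𝕀 a * 𝕀 b
𝕀-∧ true  b = sym (ℤₚ.*-identityˡ (𝕀 b))
𝕀-∧ false b = sym (ℤₚ.*-zeroˡ (𝕀 b))

𝕀-≡ᵇ : ∀ {m n} → m ≡ n → 𝕀 (m ≡ᵇ n) ≡ 1ℤ
𝕀-≡ᵇ {m} {n} eq = 𝕀-true (ℕₚ.≡⇒≡ᵇ m n eq)

𝕀-≢ᵇ : ∀ {m n} → m ≢ n → 𝕀 (m ≡ᵇ n) ≡ 0ℤ
𝕀-≢ᵇ {m} {n} neq = 𝕀-false (λ t → neq (ℕₚ.≡ᵇ⇒≡ m n t))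

𝕀-≤ᵇ : ∀ {m n} → m ≤ n → 𝕀 (m ≤ᵇ n) ≡ 1ℤ
𝕀-≤ᵇ m≤n = 𝕀-true (ℕₚ.≤⇒≤ᵇ m≤n)

𝕀-≰ᵇ : ∀ {m n} → ¬ m ≤ n → 𝕀 (m ≤ᵇ n) ≡ 0ℤ
𝕀-≰ᵇ {m} {n} m≰n = 𝕀-false (λ t → m≰n (ℕₚ.≤ᵇ⇒≤ m n t))

T⇒≡true : ∀ {b} → T b → b ≡ true
T⇒≡true {true} _ = refl

¬T⇒≡false : ∀ {b} → ¬ T b → b ≡ false
¬T⇒≡false {true}  ¬b = ⊥-elim (¬b _)
¬T⇒≡false {false} _  = refl

-- Finite sums

sumL : {A : Set} → (A → ℤ) → List A → ℤ
sumL f []       = 0ℤ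
sumL f (x ∷ xs) = f x + sumL f xs

sumBelow : (ℕ → ℤ) → ℕ → ℤ
sumBelow f zero    = 0ℤ
sumBelow f (suc m) = f 0 + sumBelow (λ i → f (suc i)) m

private
  interchange : ∀ a b c d → (a + b) + (c + d) ≡ (a + c) + (b + d)
  interchange = solve-∀

module _ {A : Set} where

  sumL-cong : {f g : A → ℤ} → (∀ x → f x ≡ g x) → ∀ xs → sumL f xs ≡ sumL g xs
  sumL-cong f≗g []       = refl
  sumL-cong f≗g (x ∷ xs) = cong₂ _+_ (f≗g x) (sumL-cong f≗g xs)

  sumL-0 : (f : A → ℤ) → (∀ x → f x ≡ 0ℤ) → ∀ xs → sumL f xs ≡ 0ℤ
  sumL-0 f f≗0 []       = refl
  sumL-0 f f≗0 (x ∷ xs) = cong₂ _+_ (f≗0 x) (sumL-0 f f≗0 xs)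

  sumL-++ : (f : A → ℤ) (xs ys : List A) → sumL f (xs ++ ys) ≡ sumL f xs + sumL f ys
  sumL-++ f []       ys = sym (ℤₚ.+-identityˡ _)
  sumL-++ f (x ∷ xs) ys =
    trans (cong (_+_ (f x)) (sumL-++ f xs ys)) (sym (ℤₚ.+-assoc (f x) _ _))

  sumL-+ : (f g : A → ℤ) (xs : List A) → sumL (λ x → f x + g x) xs ≡ sumL f xs + sumL g xs
  sumL-+ f g []       = refl
  sumL-+ f g (x ∷ xs) =
    trans (cong (_+_ (f x + g x)) (sumL-+ f g xs)) (interchange (f x) (g x) _ _)

  sumL-*ˡ : (c : ℤ) (f : A → ℤ) (xs : List A) → sumL (λ x → c * f x) xs ≡ c * sumL f xs
  sumL-*ˡ c f []       = sym (ℤₚ.*-zeroʳ c)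
  sumL-*ˡ c f (x ∷ xs) =
    trans (cong (_+_ (c * f x)) (sumL-*ˡ c f xs)) (sym (ℤₚ.*-distribˡ-+ c (f x) _))

module _ {A B : Set} where

  sumL-map : (f : B → ℤ) (g : A → B) (xs : List A) → sumL f (map g xs) ≡ sumL (λ x → f (g x)) xs
  sumL-map f g []       = refl
  sumL-map f g (x ∷ xs) = cong (_+_ (f (g x))) (sumL-map f g xs)

  sumL-concatMap : (f : B → ℤ) (g : A → List B) (xs : List A) →
                   sumL f (concatMap g xs) ≡ sumL (λ x → sumL f (g x)) xs
  sumL-concatMap f g []       = refl
  sumL-concatMap f g (x ∷ xs) =
    trans (sumL-++ f (g x) (concatMap g xs)) (cong (_+_ (sumL f (g x))) (sumL-concatMap f g xs))

  sumL²-+ : (F G : A → B → ℤ) (xs : List A) (ys : List B) →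
            sumL (λ x → sumL (λ y → F x y + G x y) ys) xs ≡
            sumL (λ x → sumL (F x) ys) xs + sumL (λ x → sumL (G x) ys) xs
  sumL²-+ F G xs ys = trans (sumL-cong (λ x → sumL-+ (F x) (G x) ys) xs) (sumL-+ _ _ xs)

  sumL-*-sumL : (f : A → ℤ) (g : B → ℤ) (xs : List A) (ys : List B) →
                sumL (λ x → sumL (λ y → f x * g y) ys) xs ≡ sumL f xs * sumL g ys
  sumL-*-sumL f g xs ys = begin
    sumL (λ x → sumL (λ y → f x * g y) ys) xs ≡⟨ sumL-cong (λ x → sumL-*ˡ (f x) g ys) xs ⟩
    sumL (λ x → f x * sumL g ys) xs          ≡⟨ sumL-cong (λ x → ℤₚ.*-comm (f x) _) xs ⟩
    sumL (λ x → sumL g ys * f x) xs          ≡⟨ sumL-*ˡ (sumL g ys) f xs ⟩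
    sumL g ys * sumL f xs                    ≡⟨ ℤₚ.*-comm (sumL g ys) _ ⟩
    sumL f xs * sumL g ys                    ∎
    where open ≡-Reasoning

sumL-applyUpTo : (f : ℕ → ℤ) (φ : ℕ → ℕ) (m : ℕ) →
                 sumL f (applyUpTo φ m) ≡ sumBelow (λ i → f (φ i)) m
sumL-applyUpTo f φ zero    = refl
sumL-applyUpTo f φ (suc m) = cong (_+_ (f (φ 0))) (sumL-applyUpTo f (λ i → φ (suc i)) m)

sumL-listsOfLength-suc : {A : Set} (F : List A → ℤ) (L : ℕ) (xs : List A) →
  sumL F (listsOfLength (suc L) xs) ≡ sumL (λ y → sumL (λ l → F (y ∷ l)) (listsOfLength L xs)) xs
sumL-listsOfLength-suc F L xs =
  trans (sumL-concatMap F (λ x → map (x ∷_) (listsOfLength L xs)) xs)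
        (sumL-cong (λ x → sumL-map F (x ∷_) (listsOfLength L xs)) xs)

sumℕ-filterᵇ : {A : Set} (p : A → Bool) (f : A → ℕ) (xs : List A) →
               + sumℕ (map f (filterᵇ p xs)) ≡ sumL (λ x → 𝕀 (p x) * + f x) xs
sumℕ-filterᵇ p f []       = refl
sumℕ-filterᵇ p f (x ∷ xs) with p x
... | true  = trans (ℤₚ.pos-+ (f x) _) (cong₂ _+_ (sym (ℤₚ.*-identityˡ (+ f x))) (sumℕ-filterᵇ p f xs))
... | false = trans (sumℕ-filterᵇ p f xs) (sym (ℤₚ.+-identityˡ _))

sumBelow-cong : ∀ {f g : ℕ → ℤ} m → (∀ i → i < m → f i ≡ g i) → sumBelow f m ≡ sumBelow g m
sumBelow-cong zero    f≗g = refl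
sumBelow-cong (suc m) f≗g =
  cong₂ _+_ (f≗g 0 (s≤s z≤n)) (sumBelow-cong m (λ i i<m → f≗g (suc i) (s≤s i<m)))

sumBelow-0 : ∀ (f : ℕ → ℤ) m → (∀ i → i < m → f i ≡ 0ℤ) → sumBelow f m ≡ 0ℤ
sumBelow-0 f zero    f≗0 = refl
sumBelow-0 f (suc m) f≗0 =
  cong₂ _+_ (f≗0 0 (s≤s z≤n)) (sumBelow-0 (λ i → f (suc i)) m (λ i i<m → f≗0 (suc i) (s≤s i<m)))

sumBelow-+ : ∀ (f g : ℕ → ℤ) m → sumBelow (λ i → f i + g i) m ≡ sumBelow f m + sumBelow g m
sumBelow-+ f g zero    = refl
sumBelow-+ f g (suc m) =
  trans (cong (_+_ (f 0 + g 0)) (sumBelow-+ (λ i → f (suc i)) (λ i → g (suc i)) m))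
        (interchange (f 0) (g 0) _ _)

sumBelow-*ˡ : ∀ (c : ℤ) (f : ℕ → ℤ) m → sumBelow (λ i → c * f i) m ≡ c * sumBelow f m
sumBelow-*ˡ c f zero    = sym (ℤₚ.*-zeroʳ c)
sumBelow-*ˡ c f (suc m) =
  trans (cong (_+_ (c * f 0)) (sumBelow-*ˡ c (λ i → f (suc i)) m))
        (sym (ℤₚ.*-distribˡ-+ c (f 0) _))

sumBelow-split : ∀ (f : ℕ → ℤ) a b →
                 sumBelow f (a ℕ.+ b) ≡ sumBelow f a + sumBelow (λ i → f (a ℕ.+ i)) b
sumBelow-split f zero    b = sym (ℤₚ.+-identityˡ _)
sumBelow-split f (suc a) b =
  trans (cong (_+_ (f 0)) (sumBelow-split (λ i → f (suc i)) a b)) (sym (ℤₚ.+-assoc (f 0) _ _))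

sumBelow-suc : ∀ (f : ℕ → ℤ) m → sumBelow f (suc m) ≡ sumBelow f m + f m
sumBelow-suc f m = begin
  sumBelow f (suc m)                      ≡⟨ cong (sumBelow f) (ℕₚ.+-comm 1 m) ⟩
  sumBelow f (m ℕ.+ 1)                    ≡⟨ sumBelow-split f m 1 ⟩
  sumBelow f m + (f (m ℕ.+ 0) + 0ℤ)       ≡⟨ cong (λ x → sumBelow f m + (f x + 0ℤ)) (ℕₚ.+-identityʳ m) ⟩
  sumBelow f m + (f m + 0ℤ)               ≡⟨ cong (_+_ (sumBelow f m)) (ℤₚ.+-identityʳ (f m)) ⟩
  sumBelow f m + f m                      ∎
  where open ≡-Reasoning

sumBelow-extend : ∀ (f : ℕ → ℤ) m M → m ≤ M → (∀ i → m ≤ i → i < M → f i ≡ 0ℤ) →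
                  sumBelow f M ≡ sumBelow f m
sumBelow-extend f m M m≤M f≗0 with ℕₚ.m≤n⇒∃[o]m+o≡n m≤M
... | j , refl =
  trans (sumBelow-split f m j)
  (trans (cong (_+_ (sumBelow f m))
               (sumBelow-0 _ j (λ i i<j → f≗0 (m ℕ.+ i) (ℕₚ.m≤m+n m i) (ℕₚ.+-monoʳ-< m i<j))))
         (ℤₚ.+-identityʳ _))

sumBelow-single : ∀ (f : ℕ → ℤ) m j → j < m → (∀ i → i < m → i ≢ j → f i ≡ 0ℤ) →
                  sumBelow f m ≡ f j
sumBelow-single f (suc m) zero    _         f≗0 =
  trans (cong (_+_ (f 0)) (sumBelow-0 _ m (λ i i<m → f≗0 (suc i) (s≤s i<m) (λ ()))))
        (ℤₚ.+-identityʳ (f 0))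
sumBelow-single f (suc m) (suc j) (s≤s j<m) f≗0 =
  trans (cong (_+ sumBelow (λ i → f (suc i)) m) (f≗0 0 (s≤s z≤n) (λ ())))
  (trans (ℤₚ.+-identityˡ _)
         (sumBelow-single (λ i → f (suc i)) m j j<m
            (λ i i<m i≢j → f≗0 (suc i) (s≤s i<m) (λ eq → i≢j (ℕₚ.suc-injective eq)))))

sumBelow-comm : ∀ (F : ℕ → ℕ → ℤ) a b →
                sumBelow (λ i → sumBelow (F i) b) a ≡ sumBelow (λ j → sumBelow (λ i → F i j) a) b
sumBelow-comm F zero    b = sym (sumBelow-0 (λ _ → 0ℤ) b (λ _ _ → refl))
sumBelow-comm F (suc a) b =
  trans (cong (_+_ (sumBelow (F 0) b)) (sumBelow-comm (λ i → F (suc i)) a b))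
        (sym (sumBelow-+ (F 0) (λ j → sumBelow (λ i → F (suc i) j) a) b))

sumBelow-sumL : {A : Set} (F : ℕ → A → ℤ) (xs : List A) (m : ℕ) →
                sumBelow (λ i → sumL (F i) xs) m ≡ sumL (λ x → sumBelow (λ i → F i x) m) xs
sumBelow-sumL F []       m = sumBelow-0 (λ _ → 0ℤ) m (λ _ _ → refl)
sumBelow-sumL F (x ∷ xs) m =
  trans (sumBelow-+ (λ i → F i x) (λ i → sumL (F i) xs) m)
        (cong (_+_ (sumBelow (λ i → F i x) m)) (sumBelow-sumL F xs m))
-- Power series in q

ℤ⟦q⟧ : Set
ℤ⟦q⟧ = ℕ → ℤ

infix  4 _≋_
infixl 6 _⊕_
infixl 7 _⊛_

_≋_ : ℤ⟦q⟧ → ℤ⟦q⟧ → Set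
f ≋ g = ∀ n → f n ≡ g n

≋-trans : ∀ {f g h} → f ≋ g → g ≋ h → f ≋ h
≋-trans f≋g g≋h n = trans (f≋g n) (g≋h n)

_⊕_ : ℤ⟦q⟧ → ℤ⟦q⟧ → ℤ⟦q⟧
(f ⊕ g) n = f n + g n

⊖_ : ℤ⟦q⟧ → ℤ⟦q⟧
(⊖ f) n = - f n

const : ℤ → ℤ⟦q⟧
const c zero    = c
const c (suc n) = 0ℤ

𝟘 𝟙 : ℤ⟦q⟧
𝟘 = const 0ℤ
𝟙 = const 1ℤ

𝟘≗0 : ∀ n → 𝟘 n ≡ 0ℤ
𝟘≗0 zero    = refl
𝟘≗0 (suc n) = refl

shift : ℤ⟦q⟧ → ℤ⟦q⟧
shift f n = f (suc n)

_⊛_ : ℤ⟦q⟧ → ℤ⟦q⟧ → ℤ⟦q⟧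
(f ⊛ g) zero    = f 0 * g 0
(f ⊛ g) (suc n) = f 0 * g (suc n) + (shift f ⊛ g) n

scale : ℤ → ℤ⟦q⟧ → ℤ⟦q⟧
scale c f n = c * f n

⊛-cong : ∀ {f f′ g g′} → f ≋ f′ → g ≋ g′ → f ⊛ g ≋ f′ ⊛ g′
⊛-cong f≋f′ g≋g′ zero    = cong₂ _*_ (f≋f′ 0) (g≋g′ 0)
⊛-cong f≋f′ g≋g′ (suc n) =
  cong₂ _+_ (cong₂ _*_ (f≋f′ 0) (g≋g′ (suc n))) (⊛-cong (λ i → f≋f′ (suc i)) g≋g′ n)

⊛-vanishˡ : ∀ {f} g → (∀ i → f i ≡ 0ℤ) → ∀ n → (f ⊛ g) n ≡ 0ℤ
⊛-vanishˡ g f≗0 zero    = trans (cong (_* g 0) (f≗0 0)) (ℤₚ.*-zeroˡ (g 0))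
⊛-vanishˡ g f≗0 (suc n) =
  trans (cong₂ _+_ (trans (cong (_* g (suc n)) (f≗0 0)) (ℤₚ.*-zeroˡ (g (suc n))))
                   (⊛-vanishˡ g (λ i → f≗0 (suc i)) n))
        (ℤₚ.+-identityˡ 0ℤ)

⊛-zeroˡ : ∀ g → 𝟘 ⊛ g ≋ 𝟘
⊛-zeroˡ g n = trans (⊛-vanishˡ g 𝟘≗0 n) (sym (𝟘≗0 n))

⊛-identityˡ : ∀ g → 𝟙 ⊛ g ≋ g
⊛-identityˡ g zero    = ℤₚ.*-identityˡ (g 0)
⊛-identityˡ g (suc n) =
  trans (cong₂ _+_ (ℤₚ.*-identityˡ (g (suc n))) (⊛-vanishˡ g (λ _ → refl) n)) (ℤₚ.+-identityʳ _)

⊛-distribˡ : ∀ f g h → f ⊛ (g ⊕ h) ≋ f ⊛ g ⊕ f ⊛ h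
⊛-distribˡ f g h zero    = ℤₚ.*-distribˡ-+ (f 0) (g 0) (h 0)
⊛-distribˡ f g h (suc n) =
  trans (cong₂ _+_ (ℤₚ.*-distribˡ-+ (f 0) (g (suc n)) (h (suc n))) (⊛-distribˡ (shift f) g h n))
        (interchange (f 0 * g (suc n)) (f 0 * h (suc n)) ((shift f ⊛ g) n) ((shift f ⊛ h) n))

⊛-distribʳ : ∀ f g h → (f ⊕ g) ⊛ h ≋ f ⊛ h ⊕ g ⊛ h
⊛-distribʳ f g h zero    = ℤₚ.*-distribʳ-+ (h 0) (f 0) (g 0)
⊛-distribʳ f g h (suc n) =
  trans (cong₂ _+_ (ℤₚ.*-distribʳ-+ (h (suc n)) (f 0) (g 0)) (⊛-distribʳ (shift f) (shift g) h n))
        (interchange (f 0 * h (suc n)) (g 0 * h (suc n)) ((shift f ⊛ h) n) ((shift g ⊛ h) n))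

scale-⊛ : ∀ c f g → scale c f ⊛ g ≋ scale c (f ⊛ g)
scale-⊛ c f g zero    = ℤₚ.*-assoc c (f 0) (g 0)
scale-⊛ c f g (suc n) =
  trans (cong₂ _+_ (ℤₚ.*-assoc c (f 0) (g (suc n))) (scale-⊛ c (shift f) g n))
        (sym (ℤₚ.*-distribˡ-+ c _ _))

const-⊛ : ∀ c g → const c ⊛ g ≋ scale c g
const-⊛ c g zero    = refl
const-⊛ c g (suc n) =
  trans (cong (_+_ (c * g (suc n))) (⊛-vanishˡ g (λ _ → refl) n)) (ℤₚ.+-identityʳ _)

⊛-suc : ∀ f g n → (f ⊛ g) (suc n) ≡ (f ⊛ shift g) n + f (suc n) * g 0
⊛-suc f g zero    = refl
⊛-suc f g (suc n) =
  trans (cong (_+_ (f 0 * g (suc (suc n)))) (⊛-suc (shift f) g n))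
        (sym (ℤₚ.+-assoc (f 0 * g (suc (suc n))) ((shift f ⊛ shift g) n) (f (suc (suc n)) * g 0)))

⊛-comm : ∀ f g → f ⊛ g ≋ g ⊛ f
⊛-comm f g zero    = ℤₚ.*-comm (f 0) (g 0)
⊛-comm f g (suc n) = begin
  f 0 * g (suc n) + (shift f ⊛ g) n   ≡⟨ cong₂ _+_ (ℤₚ.*-comm (f 0) (g (suc n))) (⊛-comm (shift f) g n) ⟩
  g (suc n) * f 0 + (g ⊛ shift f) n   ≡⟨ ℤₚ.+-comm (g (suc n) * f 0) ((g ⊛ shift f) n) ⟩
  (g ⊛ shift f) n + g (suc n) * f 0   ≡⟨ sym (⊛-suc g f n) ⟩
  (g ⊛ f) (suc n)                     ∎
  where open ≡-Reasoning

⊛-vanishʳ : ∀ f {g} → (∀ i → g i ≡ 0ℤ) → ∀ n → (f ⊛ g) n ≡ 0ℤ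
⊛-vanishʳ f {g} g≗0 n = trans (⊛-comm f g n) (⊛-vanishˡ f g≗0 n)

⊛-identityʳ : ∀ g → g ⊛ 𝟙 ≋ g
⊛-identityʳ g n = trans (⊛-comm g 𝟙 n) (⊛-identityˡ g n)

⊛-zeroʳ : ∀ f → f ⊛ 𝟘 ≋ 𝟘
⊛-zeroʳ f n = trans (⊛-comm f 𝟘 n) (⊛-zeroˡ f n)

⊛-scaleʳ : ∀ c f g n → (f ⊛ scale c g) n ≡ c * (f ⊛ g) n
⊛-scaleʳ c f g n = trans (⊛-comm f (scale c g) n) (trans (scale-⊛ c g f n) (cong (c *_) (⊛-comm g f n)))

⊛-assoc : ∀ f g h → (f ⊛ g) ⊛ h ≋ f ⊛ (g ⊛ h)
⊛-assoc f g h zero    = ℤₚ.*-assoc (f 0) (g 0) (h 0)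
⊛-assoc f g h (suc n) = begin
  f 0 * g 0 * h (suc n) + (shift (f ⊛ g) ⊛ h) n
    ≡⟨ cong (_+_ (f 0 * g 0 * h (suc n))) (⊛-distribʳ (scale (f 0) (shift g)) (shift f ⊛ g) h n) ⟩
  f 0 * g 0 * h (suc n) + ((scale (f 0) (shift g) ⊛ h) n + ((shift f ⊛ g) ⊛ h) n)
    ≡⟨ cong₂ (λ a b → f 0 * g 0 * h (suc n) + (a + b)) (scale-⊛ (f 0) (shift g) h n) (⊛-assoc (shift f) g h n) ⟩
  f 0 * g 0 * h (suc n) + (f 0 * (shift g ⊛ h) n + (shift f ⊛ (g ⊛ h)) n)
    ≡⟨ regroup (f 0) (g 0) (h (suc n)) ((shift g ⊛ h) n) ((shift f ⊛ (g ⊛ h)) n) ⟩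
  f 0 * (g 0 * h (suc n) + (shift g ⊛ h) n) + (shift f ⊛ (g ⊛ h)) n
    ∎
  where
  open ≡-Reasoning
  regroup : ∀ a b c d e → a * b * c + (a * d + e) ≡ a * (b * c + d) + e
  regroup = solve-∀

⊛-sumBelow : ∀ f g n → (f ⊛ g) n ≡ sumBelow (λ i → f i * g (n ∸ i)) (suc n)
⊛-sumBelow f g zero    = sym (ℤₚ.+-identityʳ _)
⊛-sumBelow f g (suc n) = cong (_+_ (f 0 * g (suc n))) (⊛-sumBelow (shift f) g n)

⊛-cong-≤ : ∀ f {g g′} n → (∀ i → i ≤ n → g i ≡ g′ i) → (f ⊛ g) n ≡ (f ⊛ g′) n
⊛-cong-≤ f {g} {g′} n g≗g′ =
  trans (⊛-sumBelow f g n)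
  (trans (sumBelow-cong (suc n) (λ i _ → cong (f i *_) (g≗g′ (n ∸ i) (ℕₚ.m∸n≤m n i))))
         (sym (⊛-sumBelow f g′ n)))


ℤ⟦q⟧-commutativeRing : CommutativeRing _ _
ℤ⟦q⟧-commutativeRing = record
  { Carrier = ℤ⟦q⟧ ; _≈_ = _≋_ ; _+_ = _⊕_ ; _*_ = _⊛_ ; -_ = ⊖_ ; 0# = 𝟘 ; 1# = 𝟙
  ; isCommutativeRing = record
    { isRing = record
      { +-isAbelianGroup = record
        { isGroup = record
          { isMonoid = record
            { isSemigroup = record
              { isMagma = record
                { isEquivalence = record { refl = λ _ → refl ; sym = λ e n → sym (e n) ; trans = ≋-trans }
                ; ∙-cong = λ e e′ n → cong₂ _+_ (e n) (e′ n) }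
              ; assoc = λ f g h n → ℤₚ.+-assoc (f n) (g n) (h n) }
            ; identity = (λ f n → trans (cong (_+ f n) (𝟘≗0 n)) (ℤₚ.+-identityˡ (f n)))
                       , (λ f n → trans (cong (_+_ (f n)) (𝟘≗0 n)) (ℤₚ.+-identityʳ (f n))) }
          ; inverse = (λ f n → trans (ℤₚ.+-inverseˡ (f n)) (sym (𝟘≗0 n)))
                    , (λ f n → trans (ℤₚ.+-inverseʳ (f n)) (sym (𝟘≗0 n)))
          ; ⁻¹-cong = λ e n → cong -_ (e n) }
        ; comm = λ f g n → ℤₚ.+-comm (f n) (g n) }
      ; *-cong = ⊛-cong
      ; *-assoc = ⊛-assoc
      ; *-identity = ⊛-identityˡ , ⊛-identityʳ
      ; distrib = ⊛-distribˡ , (λ h f g → ⊛-distribʳ f g h) }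
    ; *-comm = ⊛-comm } }

const-homomorphism : +-*-rawRing -Raw-AlmostCommutative⟶ fromCommutativeRing ℤ⟦q⟧-commutativeRing
const-homomorphism = record
  { ⟦_⟧    = const
  ; +-homo = λ a b → λ { zero → refl ; (suc n) → refl }
  ; *-homo = λ a b → λ { zero    → refl
                       ; (suc n) → sym (trans (const-⊛ a (const b) (suc n)) (ℤₚ.*-zeroʳ a)) }
  ; -‿homo = λ a → λ { zero → refl ; (suc n) → refl }
  ; 0-homo = λ { zero → refl ; (suc n) → refl }
  ; 1-homo = λ _ → refl }

const-≟ : ∀ a b → Maybe (const a ≋ const b)
const-≟ a b with a Data.Integer.≟ b
... | yes refl = just (λ _ → refl)
... | no _     = nothing

module ℤ⟦q⟧-Solver = RingSolver +-*-rawRing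
  (fromCommutativeRing ℤ⟦q⟧-commutativeRing) const-homomorphism const-≟

open ℤ⟦q⟧-Solver using (solve; _:=_; _:+_; _:*_; _:-_; :-_; con)

infix 9 q^_
q^_ : ℕ → ℤ⟦q⟧
(q^ d) n = 𝕀 (d ≡ᵇ n)

𝟙≗𝕀 : ∀ n → 𝟙 n ≡ 𝕀 (0 ≡ᵇ n) * 1ℤ
𝟙≗𝕀 zero    = refl
𝟙≗𝕀 (suc n) = refl

q^0≋𝟙 : q^ 0 ≋ 𝟙
q^0≋𝟙 zero    = refl
q^0≋𝟙 (suc n) = refl

q^-⊛-+ : ∀ d f m → (q^ d ⊛ f) (d ℕ.+ m) ≡ f m
q^-⊛-+ zero    f m = trans (⊛-cong q^0≋𝟙 (λ _ → refl) m) (⊛-identityˡ f m)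
q^-⊛-+ (suc d) f m = trans (ℤₚ.+-identityˡ _) (q^-⊛-+ d f m)

q^-⊛-< : ∀ d f n → n < d → (q^ d ⊛ f) n ≡ 0ℤ
q^-⊛-< (suc d) f zero    _         = refl
q^-⊛-< (suc d) f (suc n) (s≤s n<d) = trans (ℤₚ.+-identityˡ _) (q^-⊛-< d f n n<d)

q^-⊛ : ∀ d f n → (q^ d ⊛ f) n ≡ 𝕀 (d ≤ᵇ n) * f (n ∸ d)
q^-⊛ d f n with d ℕ.≤? n
... | no d≰n =
  trans (q^-⊛-< d f n (ℕₚ.≰⇒> d≰n))
        (sym (trans (cong (_* f (n ∸ d)) (𝕀-≰ᵇ d≰n)) (ℤₚ.*-zeroˡ (f (n ∸ d)))))
... | yes d≤n with ℕₚ.m≤n⇒∃[o]m+o≡n d≤n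
...   | m , refl = trans (q^-⊛-+ d f m)
  (sym (trans (cong₂ _*_ (𝕀-≤ᵇ d≤n) (cong f (ℕₚ.m+n∸m≡n d m))) (ℤₚ.*-identityˡ (f m))))

infix 8 𝟙⊖_
𝟙⊖_ : ℤ⟦q⟧ → ℤ⟦q⟧
𝟙⊖ x = 𝟙 ⊕ const (- 1ℤ) ⊛ x

𝟙⊖q^-⊛-coefficients : ∀ d (f g : ℤ⟦q⟧) → (∀ n → n < d → f n ≡ g n) →
                (∀ m → f (d ℕ.+ m) - f m ≡ g (d ℕ.+ m)) → (𝟙⊖ q^ d) ⊛ f ≋ g
𝟙⊖q^-⊛-coefficients d f g low step n = trans difference (aux n)
  where
  difference : ((𝟙⊖ q^ d) ⊛ f) n ≡ f n - (q^ d ⊛ f) n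
  difference = begin
    ((𝟙⊖ q^ d) ⊛ f) n
      ≡⟨ ⊛-distribʳ 𝟙 (const (- 1ℤ) ⊛ q^ d) f n ⟩
    (𝟙 ⊛ f) n + ((const (- 1ℤ) ⊛ q^ d) ⊛ f) n
      ≡⟨ cong₂ _+_ (⊛-identityˡ f n) (⊛-assoc (const (- 1ℤ)) (q^ d) f n) ⟩
    f n + (const (- 1ℤ) ⊛ (q^ d ⊛ f)) n
      ≡⟨ cong (_+_ (f n)) (trans (const-⊛ (- 1ℤ) (q^ d ⊛ f) n) (ℤₚ.-1*i≡-i _)) ⟩
    f n - (q^ d ⊛ f) n                                  ∎
    where open ≡-Reasoning
  aux : ∀ n → f n - (q^ d ⊛ f) n ≡ g n
  aux n with d ℕ.≤? n
  ... | no d≰n = trans (cong (λ s → f n - s) (q^-⊛-< d f n (ℕₚ.≰⇒> d≰n)))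
                       (trans (ℤₚ.+-identityʳ (f n)) (low n (ℕₚ.≰⇒> d≰n)))
  ... | yes d≤n with ℕₚ.m≤n⇒∃[o]m+o≡n d≤n
  ...   | m , refl = trans (cong (λ s → f (d ℕ.+ m) - s) (q^-⊛-+ d f m)) (step m)

-- Jets: value, δ_z and δ_z² at z = 1

weighted : (ℤ → ℤ) → LP → ℤ
weighted w = sumL (λ t → w (proj₁ t) * proj₂ t)

w₀ w₁ w₂ : ℤ → ℤ
w₀ _ = 1ℤ
w₁ e = e
w₂ e = e * e

evalAt1-δz²≡weighted₂ : ∀ p → evalAt1 (δz (δz p)) ≡ weighted w₂ p
evalAt1-δz²≡weighted₂ []      = refl
evalAt1-δz²≡weighted₂ (t ∷ p) =
  cong₂ _+_ (sym (ℤₚ.*-assoc (proj₁ t) (proj₁ t) (proj₂ t))) (evalAt1-δz²≡weighted₂ p)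

weighted-lpMul : ∀ w p r → weighted w (lpMul p r) ≡
  sumL (λ t → sumL (λ s → w (proj₁ t + proj₁ s) * (proj₂ t * proj₂ s)) r) p
weighted-lpMul w p r =
  trans (sumL-concatMap _ _ p) (sumL-cong (λ t → sumL-map _ _ r) p)

module _ (p r : LP) where

  private
    W₀ W₁ W₂ : LP → ℤ
    W₀ = weighted w₀
    W₁ = weighted w₁
    W₂ = weighted w₂

  weighted₀-lpMul : W₀ (lpMul p r) ≡ W₀ p * W₀ r
  weighted₀-lpMul =
    trans (weighted-lpMul w₀ p r)
    (trans (sumL-cong (λ t → sumL-cong (λ s → expand (proj₂ t) (proj₂ s)) r) p)
           (sumL-*-sumL _ _ p r))
    where
    expand : ∀ c d → 1ℤ * (c * d) ≡ (1ℤ * c) * (1ℤ * d)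
    expand = solve-∀

  weighted₁-lpMul : W₁ (lpMul p r) ≡ W₁ p * W₀ r + W₀ p * W₁ r
  weighted₁-lpMul =
    trans (weighted-lpMul w₁ p r)
    (trans (sumL-cong (λ t → sumL-cong (λ s → expand (proj₁ t) (proj₁ s) (proj₂ t) (proj₂ s)) r) p)
    (trans (sumL²-+ _ _ p r) (cong₂ _+_ (sumL-*-sumL _ _ p r) (sumL-*-sumL _ _ p r))))
    where
    expand : ∀ a b c d → (a + b) * (c * d) ≡ (a * c) * (1ℤ * d) + (1ℤ * c) * (b * d)
    expand = solve-∀

  weighted₂-lpMul : W₂ (lpMul p r) ≡ W₂ p * W₀ r + + 2 * (W₁ p * W₁ r) + W₀ p * W₂ r
  weighted₂-lpMul =
    trans (weighted-lpMul w₂ p r)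
    (trans (sumL-cong (λ t → sumL-cong (λ s → expand (proj₁ t) (proj₁ s) (proj₂ t) (proj₂ s)) r) p)
    (trans (sumL²-+ _ _ p r)
    (cong₂ _+_ (trans (sumL²-+ _ _ p r)
                      (cong₂ _+_ (sumL-*-sumL _ _ p r)
                                 (trans (sumL-*-sumL _ _ p r)
                                   (trans (cong (_* W₁ r) (sumL-*ˡ (+ 2) _ p)) (ℤₚ.*-assoc (+ 2) (W₁ p) (W₁ r))))))
               (sumL-*-sumL _ _ p r))))
    where
    expand : ∀ a b c d → (a + b) * (a + b) * (c * d) ≡
             ((a * a * c) * (1ℤ * d) + (+ 2 * (a * c)) * (b * d)) + (1ℤ * c) * (b * b * d)
    expand = solve-∀

moment : (ℤ → ℤ) → Series → ℤ⟦q⟧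
moment w F n = weighted w (F n)

moment-sMul : ∀ w f g n →
  moment w (sMul f g) n ≡ sumBelow (λ i → weighted w (lpMul (f i) (g (n ∸ i)))) (suc n)
moment-sMul w f g n =
  trans (sumL-concatMap (λ t → w (proj₁ t) * proj₂ t) term (upTo (suc n)))
        (sumL-applyUpTo (λ i → weighted w (term i)) (λ i → i) (suc n))
  where
  term : ℕ → LP
  term i = lpMul (f i) (g (n ∸ i))

record Jet : Set where
  constructor ⟨_,_,_⟩
  field μ₀ μ₁ μ₂ : ℤ⟦q⟧
open Jet

jet : Series → Jet
jet F = ⟨ moment w₀ F , moment w₁ F , moment w₂ F ⟩

-- Leibniz rule: δ(fg) = δf·g + f·δg and δ²(fg) = δ²f·g + 2 δf·δg + f·δ²g.
infixl 7 _⊗_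
_⊗_ : Jet → Jet → Jet
⟨ a , b , c ⟩ ⊗ ⟨ a′ , b′ , c′ ⟩ =
  ⟨ a ⊛ a′ , b ⊛ a′ ⊕ a ⊛ b′ , c ⊛ a′ ⊕ const (+ 2) ⊛ (b ⊛ b′) ⊕ a ⊛ c′ ⟩

infix 4 _≈ʲ_
record _≈ʲ_ (x y : Jet) : Set where
  constructor ≈⟨_,_,_⟩
  field μ₀≋ : μ₀ x ≋ μ₀ y
        μ₁≋ : μ₁ x ≋ μ₁ y
        μ₂≋ : μ₂ x ≋ μ₂ y
open _≈ʲ_

≈ʲ-trans : ∀ {x y z} → x ≈ʲ y → y ≈ʲ z → x ≈ʲ z
≈ʲ-trans x≈y y≈z =
  ≈⟨ ≋-trans (μ₀≋ x≈y) (μ₀≋ y≈z)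
   , ≋-trans (μ₁≋ x≈y) (μ₁≋ y≈z)
   , ≋-trans (μ₂≋ x≈y) (μ₂≋ y≈z) ⟩

⊗-cong : ∀ {x x′ y y′} → x ≈ʲ x′ → y ≈ʲ y′ → x ⊗ y ≈ʲ x′ ⊗ y′
⊗-cong {⟨ _ , _ , _ ⟩} {⟨ _ , _ , _ ⟩} {⟨ _ , _ , _ ⟩} {⟨ _ , _ , _ ⟩}
       ≈⟨ a , b , c ⟩ ≈⟨ a′ , b′ , c′ ⟩ =
  ≈⟨ ⊛-cong a a′
   , (λ n → cong₂ _+_ (⊛-cong b a′ n) (⊛-cong a b′ n))
   , (λ n → cong₂ _+_ (cong₂ _+_ (⊛-cong c a′ n) (⊛-cong {const (+ 2)} (λ _ → refl) (⊛-cong b b′) n))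
                      (⊛-cong a c′ n)) ⟩

jet-sMul : ∀ f g → jet (sMul f g) ≈ʲ jet f ⊗ jet g
jet-sMul f g = ≈⟨ moment₀ , moment₁ , moment₂ ⟩
  where
  M₀ M₁ M₂ : Series → ℤ⟦q⟧
  M₀ = moment w₀
  M₁ = moment w₁
  M₂ = moment w₂
  convolution : (F G : ℤ⟦q⟧) → ℕ → ℕ → ℤ
  convolution F G n i = F i * G (n ∸ i)
  moment₀ : M₀ (sMul f g) ≋ M₀ f ⊛ M₀ g
  moment₀ n = trans (moment-sMul w₀ f g n)
    (trans (sumBelow-cong (suc n) (λ i _ → weighted₀-lpMul (f i) (g (n ∸ i))))
           (sym (⊛-sumBelow (M₀ f) (M₀ g) n)))
  moment₁ : M₁ (sMul f g) ≋ M₁ f ⊛ M₀ g ⊕ M₀ f ⊛ M₁ g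
  moment₁ n = trans (moment-sMul w₁ f g n)
    (trans (sumBelow-cong (suc n) (λ i _ → weighted₁-lpMul (f i) (g (n ∸ i))))
    (trans (sumBelow-+ (convolution (M₁ f) (M₀ g) n) (convolution (M₀ f) (M₁ g) n) (suc n))
           (sym (cong₂ _+_ (⊛-sumBelow (M₁ f) (M₀ g) n) (⊛-sumBelow (M₀ f) (M₁ g) n)))))
  moment₂ : M₂ (sMul f g) ≋ M₂ f ⊛ M₀ g ⊕ const (+ 2) ⊛ (M₁ f ⊛ M₁ g) ⊕ M₀ f ⊛ M₂ g
  moment₂ n = trans (moment-sMul w₂ f g n)
    (trans (sumBelow-cong (suc n) (λ i _ → weighted₂-lpMul (f i) (g (n ∸ i))))
    (trans (sumBelow-+ (λ i → convolution (M₂ f) (M₀ g) n i + + 2 * convolution (M₁ f) (M₁ g) n i)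
                       (convolution (M₀ f) (M₂ g) n) (suc n))
    (cong₂ _+_
      (trans (sumBelow-+ (convolution (M₂ f) (M₀ g) n) (λ i → + 2 * convolution (M₁ f) (M₁ g) n i) (suc n))
        (cong₂ _+_ (sym (⊛-sumBelow (M₂ f) (M₀ g) n))
          (trans (sumBelow-*ˡ (+ 2) (convolution (M₁ f) (M₁ g) n) (suc n))
            (sym (trans (const-⊛ (+ 2) (M₁ f ⊛ M₁ g) n)
                        (cong (+ 2 *_) (⊛-sumBelow (M₁ f) (M₁ g) n)))))))
      (sym (⊛-sumBelow (M₀ f) (M₂ g) n)))))

jet-sMul-cong : ∀ f g {x y} → jet f ≈ʲ x → jet g ≈ʲ y → jet (sMul f g) ≈ʲ x ⊗ y
jet-sMul-cong f g f≈x g≈y = ≈ʲ-trans (jet-sMul f g) (⊗-cong f≈x g≈y)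

scalar-⊗ : ∀ c a s → ⟨ c , 𝟘 , 𝟘 ⟩ ⊗ ⟨ a , 𝟘 , s ⟩ ≈ʲ ⟨ c ⊛ a , 𝟘 , c ⊛ s ⟩
scalar-⊗ c a s =
  ≈⟨ (λ _ → refl)
   , solve 2 (λ c a → con 0ℤ :* a :+ c :* con 0ℤ := con 0ℤ) (λ _ → refl) c a
   , solve 3 (λ c a s → con 0ℤ :* a :+ con (+ 2) :* (con 0ℤ :* con 0ℤ) :+ c :* s := c :* s)
             (λ _ → refl) c a s ⟩

jet-sMul-scalar : ∀ f g {c a s} → jet f ≈ʲ ⟨ c , 𝟘 , 𝟘 ⟩ → jet g ≈ʲ ⟨ a , 𝟘 , s ⟩ →
                  jet (sMul f g) ≈ʲ ⟨ c ⊛ a , 𝟘 , c ⊛ s ⟩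
jet-sMul-scalar f g {c} {a} {s} f≈c g≈a = ≈ʲ-trans (jet-sMul-cong f g f≈c g≈a) (scalar-⊗ c a s)

⟨γ,τ,ε⟩⊗⟨γ,⊖τ,ε⟩ : ∀ γ τ ε → ⟨ γ , τ , ε ⟩ ⊗ ⟨ γ , ⊖ τ , ε ⟩ ≈ʲ
                   ⟨ γ ⊛ γ , 𝟘 , ε ⊛ γ ⊕ const (+ 2) ⊛ (τ ⊛ ⊖ τ) ⊕ γ ⊛ ε ⟩
⟨γ,τ,ε⟩⊗⟨γ,⊖τ,ε⟩ γ τ ε =
  ≈⟨ (λ _ → refl) , solve 2 (λ γ τ → τ :* γ :+ γ :* (:- τ) := con 0ℤ) (λ _ → refl) γ τ , (λ _ → refl) ⟩

-- Geometric series

geomSeries : (ℕ → ℤ) → ℕ → ℤ⟦q⟧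
geomSeries v d n = sumBelow (λ t → 𝕀 (t ℕ.* d ≡ᵇ n) * v t) (suc n)

module _ (d : ℕ) where

  private
    term : (ℕ → ℤ) → ℕ → ℕ → ℤ
    term v n t = 𝕀 (t ℕ.* d ≡ᵇ n) * v t

  geomSeries-cong : ∀ {v v′} → (∀ t → v t ≡ v′ t) → geomSeries v d ≋ geomSeries v′ d
  geomSeries-cong v≗v′ n = sumBelow-cong (suc n) (λ t _ → cong (𝕀 (t ℕ.* d ≡ᵇ n) *_) (v≗v′ t))

  geomSeries-+ : ∀ v v′ → geomSeries (λ t → v t + v′ t) d ≋ geomSeries v d ⊕ geomSeries v′ d
  geomSeries-+ v v′ n =
    trans (sumBelow-cong (suc n) (λ t _ → ℤₚ.*-distribˡ-+ (𝕀 (t ℕ.* d ≡ᵇ n)) (v t) (v′ t)))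
          (sumBelow-+ (term v n) (term v′ n) (suc n))

  geomSeries-*ˡ : ∀ c v → geomSeries (λ t → c * v t) d ≋ scale c (geomSeries v d)
  geomSeries-*ˡ c v n =
    trans (sumBelow-cong (suc n) (λ t _ → swap (𝕀 (t ℕ.* d ≡ᵇ n)) c (v t)))
          (sumBelow-*ˡ c (term v n) (suc n))
    where
    swap : ∀ a b x → a * (b * x) ≡ b * (a * x)
    swap = solve-∀

  geomSeries-0 : geomSeries (λ _ → 0ℤ) d ≋ 𝟘
  geomSeries-0 n =
    trans (sumBelow-0 _ (suc n) (λ t _ → ℤₚ.*-zeroʳ (𝕀 (t ℕ.* d ≡ᵇ n)))) (sym (𝟘≗0 n))

  geomSeries-∤ : ∀ v n → ¬ d ∣ n → geomSeries v d n ≡ 0ℤ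
  geomSeries-∤ v n d∤n = sumBelow-0 _ (suc n) (λ t _ →
    trans (cong (_* v t) (𝕀-≢ᵇ (λ eq → d∤n (divides t (sym eq))))) (ℤₚ.*-zeroˡ (v t)))

module _ {d′ : ℕ} where

  private
    d = suc d′

  geomSeries-∣ : ∀ v n j → n ≡ j ℕ.* d → geomSeries v d n ≡ v j
  geomSeries-∣ v n j n≡jd =
    trans (sumBelow-single _ (suc n) j j<1+n others)
          (trans (cong (_* v j) (𝕀-≡ᵇ (sym n≡jd))) (ℤₚ.*-identityˡ (v j)))
    where
    j<1+n : j < suc n
    j<1+n = s≤s (subst (j ≤_) (sym n≡jd) (ℕₚ.m≤m*n j d))
    others : ∀ t → t < suc n → t ≢ j → 𝕀 (t ℕ.* d ≡ᵇ n) * v t ≡ 0ℤ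
    others t _ t≢j = trans (cong (_* v t) (𝕀-≢ᵇ (λ eq → t≢j (ℕₚ.*-cancelʳ-≡ t j d (trans eq n≡jd)))))
                           (ℤₚ.*-zeroˡ (v t))

  geomSeries-step : ∀ v m → geomSeries v d (d ℕ.+ m) ≡ geomSeries (λ t → v (suc t)) d m
  geomSeries-step v m with d ∣? m
  ... | yes (divides j m≡jd) =
    trans (geomSeries-∣ v (d ℕ.+ m) (suc j) (cong (d ℕ.+_) m≡jd))
          (sym (geomSeries-∣ (λ t → v (suc t)) m j m≡jd))
  ... | no d∤m =
    trans (geomSeries-∤ d v (d ℕ.+ m) (λ d∣d+m → d∤m (∣m+n∣m⇒∣n d∣d+m ∣-refl)))
          (sym (geomSeries-∤ d (λ t → v (suc t)) m d∤m))

  geomSeries-< : ∀ v n → n < d → geomSeries v d n ≡ const (v 0) n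
  geomSeries-< v zero    _   = geomSeries-∣ v 0 0 refl
  geomSeries-< v (suc n) n<d = geomSeries-∤ d v (suc n) (>⇒∤ n<d)

  geomSeries-recurrence : ∀ v → (𝟙⊖ q^ d) ⊛ geomSeries v d ≋
                                 const (v 0) ⊕ q^ d ⊛ geomSeries (λ t → v (suc t) - v t) d
  geomSeries-recurrence v = 𝟙⊖q^-⊛-coefficients d (geomSeries v d) (const (v 0) ⊕ q^ d ⊛ G Δv) low step
    where
    G : (ℕ → ℤ) → ℤ⟦q⟧
    G w = geomSeries w d
    Δv v∘suc −v : ℕ → ℤ
    Δv t = v (suc t) - v t
    v∘suc t = v (suc t)
    −v t = - 1ℤ * v t
    low : ∀ n → n < d → G v n ≡ const (v 0) n + (q^ d ⊛ G Δv) n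
    low n n<d = trans (geomSeries-< v n n<d)
      (sym (trans (cong (_+_ (const (v 0) n)) (q^-⊛-< d (G Δv) n n<d)) (ℤₚ.+-identityʳ _)))
    step : ∀ m → G v (d ℕ.+ m) - G v m ≡ const (v 0) (d ℕ.+ m) + (q^ d ⊛ G Δv) (d ℕ.+ m)
    step m = begin
      G v (d ℕ.+ m) - G v m           ≡⟨ cong (_- G v m) (geomSeries-step v m) ⟩
      G v∘suc m + - G v m             ≡⟨ cong (_+_ (G v∘suc m)) (sym (ℤₚ.-1*i≡-i _)) ⟩
      G v∘suc m + - 1ℤ * G v m        ≡⟨ cong (_+_ (G v∘suc m)) (sym (geomSeries-*ˡ d (- 1ℤ) v m)) ⟩
      G v∘suc m + G −v m              ≡⟨ sym (geomSeries-+ d v∘suc −v m) ⟩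
      G (λ t → v (suc t) + −v t) m    ≡⟨ geomSeries-cong d (λ t → cong (_+_ (v (suc t))) (ℤₚ.-1*i≡-i (v t))) m ⟩
      G Δv m                          ≡⟨ sym (q^-⊛-+ d (G Δv) m) ⟩
      (q^ d ⊛ G Δv) (d ℕ.+ m)         ≡⟨ sym (ℤₚ.+-identityˡ _) ⟩
      const (v 0) (d ℕ.+ m) + (q^ d ⊛ G Δv) (d ℕ.+ m) ∎
      where open ≡-Reasoning

γ τ ε : ℕ → ℤ⟦q⟧
γ = geomSeries (λ _ → 1ℤ)
τ = geomSeries (λ t → + t)
ε = geomSeries (λ t → + t * + t)

module _ (d′ : ℕ) where

  private
    d = suc d′

  𝟙⊖q^-⊛-γ : (𝟙⊖ q^ d) ⊛ γ d ≋ 𝟙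
  𝟙⊖q^-⊛-γ n = trans (geomSeries-recurrence (λ _ → 1ℤ) n)
    (trans (cong (_+_ (𝟙 n)) (trans (⊛-cong {q^ d} (λ _ → refl) (geomSeries-0 d) n)
                                        (trans (⊛-zeroʳ (q^ d) n) (𝟘≗0 n))))
           (ℤₚ.+-identityʳ (𝟙 n)))

  𝟙⊖q^-⊛-τ : (𝟙⊖ q^ d) ⊛ τ d ≋ q^ d ⊛ γ d
  𝟙⊖q^-⊛-τ n = trans (geomSeries-recurrence (λ t → + t) n)
    (trans (cong₂ _+_ (𝟘≗0 n) (⊛-cong {q^ d} (λ _ → refl) (geomSeries-cong d difference) n))
           (ℤₚ.+-identityˡ _))
    where
    difference : ∀ t → + suc t - + t ≡ 1ℤ
    difference t = trans (cong (_- + t) (ℤₚ.pos-+ 1 t)) (expand (+ t))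
      where
      expand : ∀ x → 1ℤ + x - x ≡ 1ℤ
      expand = solve-∀

  𝟙⊖q^-⊛-ε : (𝟙⊖ q^ d) ⊛ ε d ≋ q^ d ⊛ (const (+ 2) ⊛ τ d ⊕ γ d)
  𝟙⊖q^-⊛-ε n = trans (geomSeries-recurrence (λ t → + t * + t) n)
    (trans (cong₂ _+_ (𝟘≗0 n) (⊛-cong {q^ d} (λ _ → refl) differences n))
           (ℤₚ.+-identityˡ _))
    where
    difference : ∀ t → + suc t * + suc t - + t * + t ≡ + 2 * + t + 1ℤ
    difference t = trans (cong (λ x → x * x - + t * + t) (ℤₚ.pos-+ 1 t)) (expand (+ t))
      where
      expand : ∀ x → (1ℤ + x) * (1ℤ + x) - x * x ≡ + 2 * x + 1ℤ
      expand = solve-∀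
    differences : geomSeries (λ t → + suc t * + suc t - + t * + t) d ≋ const (+ 2) ⊛ τ d ⊕ γ d
    differences m = trans (geomSeries-cong d difference m)
      (trans (geomSeries-+ d (λ t → + 2 * + t) (λ _ → 1ℤ) m)
             (cong (_+ γ d m) (trans (geomSeries-*ˡ d (+ 2) (λ t → + t) m)
                                     (sym (const-⊛ (+ 2) (τ d) m)))))

-- The jet of the crank generating function

weighted-if : ∀ w b e c → weighted w (if b then (e , c) ∷ [] else []) ≡ 𝕀 b * (w e * c)
weighted-if w true  e c = trans (ℤₚ.+-identityʳ (w e * c)) (sym (ℤₚ.*-identityˡ (w e * c)))
weighted-if w false e c = sym (ℤₚ.*-zeroˡ (w e * c))

1+cq^ : ℤ → ℕ → Series
1+cq^ c d = poly ((+ 0 , + 1 , 0) ∷ (+ 0 , c , d) ∷ [])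

jet-1+cq^ : ∀ c d → jet (1+cq^ c d) ≈ʲ ⟨ 𝟙 ⊕ const c ⊛ q^ d , 𝟘 , 𝟘 ⟩
jet-1+cq^ c d = ≈⟨ moment₀ , moment-const w₁ refl , moment-const w₂ refl ⟩
  where
  moment-poly : ∀ w n → moment w (1+cq^ c d) n ≡
                𝕀 (0 ≡ᵇ n) * (w (+ 0) * + 1) + 𝕀 (d ≡ᵇ n) * (w (+ 0) * c)
  moment-poly w n =
    trans (sumL-concatMap (λ t → w (proj₁ t) * proj₂ t)
             (λ (t : ℤ × ℤ × ℕ) → if proj₂ (proj₂ t) ≡ᵇ n then (proj₁ t , proj₁ (proj₂ t)) ∷ [] else [])
             ((+ 0 , + 1 , 0) ∷ (+ 0 , c , d) ∷ []))
          (cong₂ _+_ (weighted-if w (0 ≡ᵇ n) (+ 0) (+ 1))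
                     (trans (ℤₚ.+-identityʳ _) (weighted-if w (d ≡ᵇ n) (+ 0) c)))
  moment₀ : moment w₀ (1+cq^ c d) ≋ 𝟙 ⊕ const c ⊛ q^ d
  moment₀ n = trans (moment-poly w₀ n)
    (cong₂ _+_ (trans (ℤₚ.*-identityʳ _) (q^0≋𝟙 n))
               (trans (cong (𝕀 (d ≡ᵇ n) *_) (ℤₚ.*-identityˡ c))
                      (trans (ℤₚ.*-comm (𝕀 (d ≡ᵇ n)) c) (sym (const-⊛ c (q^ d) n)))))
  moment-const : ∀ w → w (+ 0) ≡ 0ℤ → moment w (1+cq^ c d) ≋ 𝟘
  moment-const w w0≡0 n = trans (moment-poly w n) (trans
    (cong₂ _+_ (trans (cong (λ x → 𝕀 (0 ≡ᵇ n) * (x * + 1)) w0≡0) (ℤₚ.*-zeroʳ (𝕀 (0 ≡ᵇ n))))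
               (trans (cong (λ x → 𝕀 (d ≡ᵇ n) * (x * c)) w0≡0) (ℤₚ.*-zeroʳ (𝕀 (d ≡ᵇ n)))))
    (sym (𝟘≗0 n)))

moment-geom : ∀ w a d → moment w (geom a d) ≋ geomSeries (λ t → w (a * + t) * 1ℤ) d
moment-geom w a d n =
  trans (sumL-concatMap (λ t → w (proj₁ t) * proj₂ t) entry (upTo (suc n)))
  (trans (sumL-applyUpTo (λ t → weighted w (entry t)) (λ i → i) (suc n))
         (sumBelow-cong (suc n) (λ t _ → weighted-if w (t ℕ.* d ≡ᵇ n) (a * + t) (+ 1))))
  where
  entry : ℕ → LP
  entry t = if t ℕ.* d ≡ᵇ n then (a * + t , + 1) ∷ [] else []

jet-geom-0 : ∀ d → jet (geom (+ 0) d) ≈ʲ ⟨ γ d , 𝟘 , 𝟘 ⟩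
jet-geom-0 d = ≈⟨ moment-geom w₀ (+ 0) d , vanishing w₁ refl , vanishing w₂ refl ⟩
  where
  vanishing : ∀ w → w (+ 0) ≡ 0ℤ → moment w (geom (+ 0) d) ≋ 𝟘
  vanishing w w0≡0 n = trans (moment-geom w (+ 0) d n)
    (trans (geomSeries-cong d (λ _ → cong (_* 1ℤ) w0≡0) n) (geomSeries-0 d n))

jet-geom-z : ∀ d → jet (geom (+ 1) d) ≈ʲ ⟨ γ d , τ d , ε d ⟩
jet-geom-z d = ≈⟨ moment-geom w₀ (+ 1) d
               , ≋-trans (moment-geom w₁ (+ 1) d) (geomSeries-cong d (λ t → weight₁ (+ t)))
               , ≋-trans (moment-geom w₂ (+ 1) d) (geomSeries-cong d (λ t → weight₂ (+ t))) ⟩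
  where
  weight₁ : ∀ x → 1ℤ * x * 1ℤ ≡ x
  weight₁ = solve-∀
  weight₂ : ∀ x → 1ℤ * x * (1ℤ * x) * 1ℤ ≡ x * x
  weight₂ = solve-∀

jet-geom-z⁻¹ : ∀ d → jet (geom (- + 1) d) ≈ʲ ⟨ γ d , ⊖ τ d , ε d ⟩
jet-geom-z⁻¹ d = ≈⟨ moment-geom w₀ (- + 1) d
                 , (λ n → trans (moment-geom w₁ (- + 1) d n)
                     (trans (geomSeries-cong d (λ t → weight₁ (+ t)) n)
                     (trans (geomSeries-*ˡ d (- 1ℤ) (λ t → + t) n) (ℤₚ.-1*i≡-i (τ d n)))))
                 , ≋-trans (moment-geom w₂ (- + 1) d) (geomSeries-cong d (λ t → weight₂ (+ t))) ⟩
  where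
  weight₁ : ∀ x → - 1ℤ * x * 1ℤ ≡ - 1ℤ * x
  weight₁ = solve-∀
  weight₂ : ∀ x → - 1ℤ * x * (- 1ℤ * x) * 1ℤ ≡ x * x
  weight₂ = solve-∀

-- The hypotheses say γ = 1/(1-x), τ = x/(1-x)², ε = x(1+x)/(1-x)³: the z-moments at z = 1 of
-- 1/(1 - zx) (and of 1/(1 - x/z), with τ negated).  Multiplied by (1-x)² they become 1, 0, 2τ.
module CrankRelations (x γ τ ε : ℤ⟦q⟧)
  (cγ≋𝟙 : 𝟙⊖ x ⊛ γ ≋ 𝟙) (cτ≋xγ : 𝟙⊖ x ⊛ τ ≋ x ⊛ γ)
  (cε≋x[2τ+γ] : 𝟙⊖ x ⊛ ε ≋ x ⊛ (const (+ 2) ⊛ τ ⊕ γ)) where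

  private
    c = 𝟙⊖ x

  c²γ²≋𝟙 : c ⊛ (c ⊛ (γ ⊛ γ)) ≋ 𝟙
  c²γ²≋𝟙 =
    ≋-trans (solve 2 (λ c γ → c :* (c :* (γ :* γ)) := (c :* γ) :* (c :* γ)) (λ _ → refl) c γ)
            (≋-trans (⊛-cong cγ≋𝟙 cγ≋𝟙) (⊛-identityˡ 𝟙))

  -- The difference of both sides is  u₁ (cγ - 1) + u₂ (cτ - xγ) + u₃ (cε - x(2τ + γ)).
  c²-curvature : c ⊛ (c ⊛ (ε ⊛ γ ⊕ const (+ 2) ⊛ (τ ⊛ ⊖ τ) ⊕ γ ⊛ ε)) ≋ const (+ 2) ⊛ τ
  c²-curvature n = begin
    (c ⊛ (c ⊛ (ε ⊛ γ ⊕ const (+ 2) ⊛ (τ ⊛ ⊖ τ) ⊕ γ ⊛ ε))) n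
      ≡⟨ solve 4 (λ x γ τ ε → C x :* (C x :* (ε :* γ :+ con (+ 2) :* (τ :* (:- τ)) :+ γ :* ε)) :=
                    con (+ 2) :* τ
                    :+ ((con (+ 2) :* (C x :* ε) :- con (+ 2) :* (x :* τ)) :* (C x :* γ :- con 1ℤ)
                    :+ (:- (con (+ 2) :* (C x :* τ)) :- con (+ 2)) :* (C x :* τ :- x :* γ)
                    :+ con (+ 2) :* (C x :* ε :- x :* (con (+ 2) :* τ :+ γ))))
               (λ _ → refl) x γ τ ε n ⟩
    (const (+ 2) ⊛ τ) n + residues n
      ≡⟨ cong (_+_ ((const (+ 2) ⊛ τ) n)) (vanishes n) ⟩
    (const (+ 2) ⊛ τ) n + 0ℤ
      ≡⟨ ℤₚ.+-identityʳ _ ⟩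
    (const (+ 2) ⊛ τ) n ∎
    where
    open ≡-Reasoning
    C : ∀ {m} → ℤ⟦q⟧-Solver.Polynomial m → ℤ⟦q⟧-Solver.Polynomial m
    C x = con 1ℤ :+ con (- 1ℤ) :* x
    u₁ u₂ u₃ : ℤ⟦q⟧
    u₁ = const (+ 2) ⊛ (c ⊛ ε) ⊕ ⊖ (const (+ 2) ⊛ (x ⊛ τ))
    u₂ = ⊖ (const (+ 2) ⊛ (c ⊛ τ)) ⊕ ⊖ const (+ 2)
    u₃ = const (+ 2)
    residue : ∀ {f g} u → f ≋ g → ∀ n → (u ⊛ (f ⊕ ⊖ g)) n ≡ 0ℤ
    residue {f} {g} u f≋g = ⊛-vanishʳ u (λ m → trans (cong (_- g m) (f≋g m)) (ℤₚ.+-inverseʳ (g m)))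
    residues : ℤ⟦q⟧
    residues = u₁ ⊛ (c ⊛ γ ⊕ ⊖ 𝟙)
             ⊕ u₂ ⊛ (c ⊛ τ ⊕ ⊖ (x ⊛ γ))
             ⊕ u₃ ⊛ (c ⊛ ε ⊕ ⊖ (x ⊛ (const (+ 2) ⊛ τ ⊕ γ)))
    vanishes : ∀ n → residues n ≡ 0ℤ
    vanishes n =
      cong₂ _+_ (cong₂ _+_ (residue u₁ cγ≋𝟙 n) (residue u₂ cτ≋xγ n)) (residue u₃ cε≋x[2τ+γ] n)

ρ : ℕ → ℤ⟦q⟧
ρ j = (𝟙 ⊕ const 1ℤ ⊛ q^ j) ⊛ γ j

jet-crankFactor : ∀ k j′ → let j = suc j′ ; D = suc k ℕ.* j in
  jet (crankFactor (suc k) j) ≈ʲ ⟨ ρ j , 𝟘 , ρ j ⊛ (const (+ 2) ⊛ τ D) ⟩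
jet-crankFactor k j′ = ≈ʲ-trans expanded ≈⟨ value , (λ _ → refl) , curvature ⟩
  where
  j = suc j′
  D′ = j′ ℕ.+ k ℕ.* j
  D = suc D′
  open CrankRelations (q^ D) (γ D) (τ D) (ε D) (𝟙⊖q^-⊛-γ D′) (𝟙⊖q^-⊛-τ D′) (𝟙⊖q^-⊛-ε D′)
  a s : ℤ⟦q⟧
  a = 𝟙 ⊕ const 1ℤ ⊛ q^ j
  s = ε D ⊛ γ D ⊕ const (+ 2) ⊛ (τ D ⊛ ⊖ τ D) ⊕ γ D ⊛ ε D
  P₊ P₋ G₀ Zᶻ Zᶻ⁻¹ Z² : Series
  P₊ = 1+cq^ 1ℤ j
  P₋ = 1+cq^ (- 1ℤ) D
  G₀ = geom (+ 0) j
  Zᶻ = geom (+ 1) D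
  Zᶻ⁻¹ = geom (- 1ℤ) D
  Z² = sMul Zᶻ Zᶻ⁻¹
  expanded : jet (crankFactor (suc k) j) ≈ʲ
             ⟨ a ⊛ (γ j ⊛ (𝟙⊖ q^ D ⊛ (𝟙⊖ q^ D ⊛ (γ D ⊛ γ D))))
             , 𝟘
             , a ⊛ (γ j ⊛ (𝟙⊖ q^ D ⊛ (𝟙⊖ q^ D ⊛ s))) ⟩
  expanded =
    jet-sMul-scalar P₊ (sMul G₀ (sMul P₋ (sMul P₋ Z²))) (jet-1+cq^ 1ℤ j)
    (jet-sMul-scalar G₀ (sMul P₋ (sMul P₋ Z²)) (jet-geom-0 j)
    (jet-sMul-scalar P₋ (sMul P₋ Z²) (jet-1+cq^ (- 1ℤ) D)
    (jet-sMul-scalar P₋ Z² (jet-1+cq^ (- 1ℤ) D)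
    (≈ʲ-trans (jet-sMul-cong Zᶻ Zᶻ⁻¹ (jet-geom-z D) (jet-geom-z⁻¹ D))
              (⟨γ,τ,ε⟩⊗⟨γ,⊖τ,ε⟩ (γ D) (τ D) (ε D))))))
  value : a ⊛ (γ j ⊛ (𝟙⊖ q^ D ⊛ (𝟙⊖ q^ D ⊛ (γ D ⊛ γ D)))) ≋ ρ j
  value = ⊛-cong {a} (λ _ → refl) (≋-trans (⊛-cong {γ j} (λ _ → refl) c²γ²≋𝟙) (⊛-identityʳ (γ j)))
  curvature : a ⊛ (γ j ⊛ (𝟙⊖ q^ D ⊛ (𝟙⊖ q^ D ⊛ s))) ≋ ρ j ⊛ (const (+ 2) ⊛ τ D)
  curvature = ≋-trans (⊛-cong {a} (λ _ → refl) (⊛-cong {γ j} (λ _ → refl) c²-curvature))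
                      (λ n → sym (⊛-assoc a (γ j) (const (+ 2) ⊛ τ D) n))

R : ℕ → ℤ⟦q⟧
R zero    = 𝟙
R (suc m) = R m ⊛ ρ (suc m)

crankSum : ℕ → ℕ → ℤ⟦q⟧
crankSum k zero    = 𝟘
crankSum k (suc N) = crankSum k N ⊕ τ (k ℕ.* suc N)

jet-sOne : jet sOne ≈ʲ ⟨ 𝟙 , 𝟘 , 𝟘 ⟩
jet-sOne = ≈⟨ (λ { zero → refl ; (suc n) → refl })
            , (λ { zero → refl ; (suc n) → refl })
            , (λ { zero → refl ; (suc n) → refl }) ⟩

jet-crankProduct : ∀ k N → let F = crankFactor (suc k) in
  jet (prodTo N F) ≈ʲ ⟨ R N , 𝟘 , const (+ 2) ⊛ (R N ⊛ crankSum (suc k) N) ⟩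
jet-crankProduct k zero    = ≈ʲ-trans jet-sOne
  ≈⟨ (λ _ → refl) , (λ _ → refl) , solve 0 (con 0ℤ := con (+ 2) :* (con 1ℤ :* con 0ℤ)) (λ _ → refl) ⟩
jet-crankProduct k (suc N) =
  ≈ʲ-trans (jet-sMul-cong (prodTo N F) (F (suc N)) (jet-crankProduct k N) (jet-crankFactor k N))
  ≈⟨ (λ _ → refl)
   , solve 2 (λ r p → con 0ℤ :* p :+ r :* con 0ℤ := con 0ℤ) (λ _ → refl) (R N) (ρ (suc N))
   , solve 4 (λ r p s t → con (+ 2) :* (r :* s) :* p :+ con (+ 2) :* (con 0ℤ :* con 0ℤ) :+ r :* (p :* (con (+ 2) :* t))
                         := con (+ 2) :* ((r :* p) :* (s :+ t)))
             (λ _ → refl) (R N) (ρ (suc N)) (crankSum (suc k) N) (τ (suc k ℕ.* suc N)) ⟩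
  where
  F = crankFactor (suc k)

M2bar≡2[R⊛crankSum] : ∀ k n → M2bar (suc k) n ≡ + 2 * (R n ⊛ crankSum (suc k) n) n
M2bar≡2[R⊛crankSum] k n =
  trans (evalAt1-δz²≡weighted₂ (Cbar (suc k) n))
  (trans (μ₂≋ (jet-crankProduct k n) n) (const-⊛ (+ 2) (R n ⊛ crankSum (suc k) n) n))

-- Overpartitions, decomposed at their largest part

mayFollow : ℕ → Part → Bool
mayFollow v (w , o) = (w ≤ᵇ v) ∧ (if w ≡ᵇ v then not o else true)

mayFollow-< : ∀ {m u} o → u < m → mayFollow (suc m) (suc u , o) ≡ true
mayFollow-< {m} {u} o u<m =
  cong₂ (λ le eq → le ∧ (if eq then not o else true))
        (T⇒≡true (ℕₚ.≤⇒≤ᵇ (ℕₚ.<⇒≤ (s≤s u<m))))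
        (¬T⇒≡false (λ t → ℕₚ.<⇒≢ u<m (ℕₚ.≡ᵇ⇒≡ u m t)))

mayFollow-≡ : ∀ m o → mayFollow (suc m) (suc m , o) ≡ not o
mayFollow-≡ m o =
  cong₂ (λ le eq → le ∧ (if eq then not o else true))
        (T⇒≡true (ℕₚ.≤⇒≤ᵇ (ℕₚ.≤-refl {suc m})))
        (T⇒≡true (ℕₚ.≡⇒≡ᵇ m m refl))

mayFollow-> : ∀ {m u} o → m < u → mayFollow (suc m) (suc u , o) ≡ false
mayFollow-> {m} {u} o m<u =
  cong (λ le → le ∧ (if suc u ≡ᵇ suc m then not o else true))
       (¬T⇒≡false (λ t → ℕₚ.<⇒≱ (s≤s m<u) (ℕₚ.≤ᵇ⇒≤ (suc u) (suc m) t)))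

startsBelow : ℕ → List Part → Bool
startsBelow v []      = true
startsBelow v (y ∷ _) = mayFollow v y

isTailOf : ℕ → ℕ → List Part → Bool
isTailOf v r l = startsBelow v l ∧ isOverpartitionOf r l

wellOrdered-∷ : ∀ v o l → wellOrdered ((v , o) ∷ l) ≡ startsBelow v l ∧ wellOrdered l
wellOrdered-∷ v o []             = refl
wellOrdered-∷ v o ((w , o′) ∷ l) = sym (Boolₚ.∧-assoc (w ≤ᵇ v) _ _)

𝕀-+≡ᵇ : ∀ w s r → 𝕀 (w ℕ.+ s ≡ᵇ r) ≡ 𝕀 (w ≤ᵇ r) * 𝕀 (s ≡ᵇ r ∸ w)
𝕀-+≡ᵇ w s r with w ℕ.≤? r
... | no w≰r =
  trans (𝕀-≢ᵇ (λ w+s≡r → w≰r (subst (w ≤_) w+s≡r (ℕₚ.m≤m+n w s))))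
        (sym (trans (cong (_* 𝕀 (s ≡ᵇ r ∸ w)) (𝕀-≰ᵇ w≰r)) (ℤₚ.*-zeroˡ (𝕀 (s ≡ᵇ r ∸ w)))))
... | yes w≤r with ℕₚ.m≤n⇒∃[o]m+o≡n w≤r
...   | m , refl =
  trans (cong 𝕀 (+-≡ᵇ w))
        (sym (trans (cong₂ _*_ (𝕀-≤ᵇ w≤r) (cong (λ x → 𝕀 (s ≡ᵇ x)) (ℕₚ.m+n∸m≡n w m)))
                    (ℤₚ.*-identityˡ _)))
  where
  +-≡ᵇ : ∀ w → (w ℕ.+ s ≡ᵇ w ℕ.+ m) ≡ (s ≡ᵇ m)
  +-≡ᵇ zero    = refl
  +-≡ᵇ (suc w) = +-≡ᵇ w

topFactor : ℕ → Part → ℤ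
topFactor r (w , o) = 𝕀 (1 ≤ᵇ w) * 𝕀 (w ≤ᵇ r)

𝕀-isOverpartitionOf-∷ : ∀ r y l →
  𝕀 (isOverpartitionOf r (y ∷ l)) ≡ topFactor r y * 𝕀 (isTailOf (proj₁ y) (r ∸ proj₁ y) l)
𝕀-isOverpartitionOf-∷ r (w , o) l = begin
  𝕀 ((a ∧ p) ∧ (wellOrdered ((w , o) ∷ l) ∧ e))
    ≡⟨ cong (λ b → 𝕀 ((a ∧ p) ∧ (b ∧ e))) (wellOrdered-∷ w o l) ⟩
  𝕀 ((a ∧ p) ∧ ((c ∧ wo) ∧ e))
    ≡⟨ head ⟩
  (𝕀 a * 𝕀 p) * ((𝕀 c * 𝕀 wo) * 𝕀 e)
    ≡⟨ cong (λ x → (𝕀 a * 𝕀 p) * ((𝕀 c * 𝕀 wo) * x)) (𝕀-+≡ᵇ w Σl r) ⟩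
  (𝕀 a * 𝕀 p) * ((𝕀 c * 𝕀 wo) * (𝕀 le * 𝕀 s))
    ≡⟨ shuffle (𝕀 a) (𝕀 p) (𝕀 c) (𝕀 wo) (𝕀 le) (𝕀 s) ⟩
  (𝕀 a * 𝕀 le) * (𝕀 c * (𝕀 p * (𝕀 wo * 𝕀 s)))
    ≡⟨ cong ((𝕀 a * 𝕀 le) *_) (sym tail) ⟩
  (𝕀 a * 𝕀 le) * 𝕀 (c ∧ (p ∧ (wo ∧ s))) ∎
  where
  open ≡-Reasoning
  Σl = sumℕ (map proj₁ l)
  a p c wo e le s : Bool
  a  = 1 ≤ᵇ w
  p  = allPositive l
  c  = startsBelow w l
  wo = wellOrdered l
  e  = w ℕ.+ Σl ≡ᵇ r
  le = w ≤ᵇ r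
  s  = Σl ≡ᵇ r ∸ w
  head : 𝕀 ((a ∧ p) ∧ ((c ∧ wo) ∧ e)) ≡ (𝕀 a * 𝕀 p) * ((𝕀 c * 𝕀 wo) * 𝕀 e)
  head = trans (𝕀-∧ (a ∧ p) _) (cong₂ _*_ (𝕀-∧ a p) (trans (𝕀-∧ (c ∧ wo) e) (cong (_* 𝕀 e) (𝕀-∧ c wo))))
  tail : 𝕀 (c ∧ (p ∧ (wo ∧ s))) ≡ 𝕀 c * (𝕀 p * (𝕀 wo * 𝕀 s))
  tail = trans (𝕀-∧ c _) (cong (𝕀 c *_) (trans (𝕀-∧ p _) (cong (𝕀 p *_) (𝕀-∧ wo s))))
  shuffle : ∀ a p c wo le s → (a * p) * ((c * wo) * (le * s)) ≡ (a * le) * (c * (p * (wo * s)))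
  shuffle = solve-∀

sumFlags : (Bool → ℤ) → ℤ
sumFlags f = f false + (f true + 0ℤ)

partValue : ℕ → Part → ℤ
partValue k (w , o) = + (if not o ∧ does (k ∣? w) then w else 0)

headFactor : ℕ → ℕ → Part → ℤ
headFactor v r y = 𝕀 (mayFollow v y) * topFactor r y

topFactor-guard : ∀ r y x → (1 ≤ proj₁ y → proj₁ y ≤ r → x ≡ 0ℤ) → topFactor r y * x ≡ 0ℤ
topFactor-guard r (w , o) x guard with 1 ℕ.≤? w | w ℕ.≤? r
... | yes 1≤w | yes w≤r =
  trans (cong (topFactor r (w , o) *_) (guard 1≤w w≤r)) (ℤₚ.*-zeroʳ (topFactor r (w , o)))
... | no 1≰w  | _       =
  trans (cong (λ i → i * 𝕀 (w ≤ᵇ r) * x) (𝕀-≰ᵇ 1≰w)) (ℤₚ.*-zeroˡ x)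
... | yes _   | no w≰r  =
  trans (cong (λ i → 𝕀 (1 ≤ᵇ w) * i * x) (𝕀-≰ᵇ w≰r))
        (trans (cong (_* x) (ℤₚ.*-zeroʳ (𝕀 (1 ≤ᵇ w)))) (ℤₚ.*-zeroˡ x))

headFactor-guard : ∀ v r y x → (1 ≤ proj₁ y → proj₁ y ≤ r → x ≡ 0ℤ) → headFactor v r y * x ≡ 0ℤ
headFactor-guard v r y x guard =
  trans (ℤₚ.*-assoc (𝕀 (mayFollow v y)) _ x)
        (trans (cong (𝕀 (mayFollow v y) *_) (topFactor-guard r y x guard))
               (ℤₚ.*-zeroʳ (𝕀 (mayFollow v y))))

headWeight : ℕ → ℕ → ℕ → ℤ
headWeight m r u = sumFlags (λ o → headFactor (suc m) r (suc u , o))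

headWeight-vanish : ∀ m r u → r ≤ u → headWeight m r u ≡ 0ℤ
headWeight-vanish m r u r≤u = cong₂ _+_ (vanish false) (cong (_+ 0ℤ) (vanish true))
  where
  vanish : ∀ o → headFactor (suc m) r (suc u , o) ≡ 0ℤ
  vanish o = trans (sym (ℤₚ.*-identityʳ _))
                   (headFactor-guard (suc m) r (suc u , o) 1ℤ (λ _ u<r → ⊥-elim (ℕₚ.<⇒≱ u<r r≤u)))

sumFlags-*ʳ : ∀ f x → sumFlags (λ o → f o * x) ≡ sumFlags f * x
sumFlags-*ʳ f x = distrib (f false) (f true) x
  where
  distrib : ∀ a b x → a * x + (b * x + 0ℤ) ≡ (a + (b + 0ℤ)) * x
  distrib = solve-∀

module Enumeration (k N : ℕ) where

  parts : List Part
  parts = candidateParts N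

  lists : ℕ → List (List Part)
  lists L = listsOfLength L parts

  sumL-parts : ∀ F → sumL F parts ≡ sumBelow (λ u → sumFlags (λ o → F (suc u , o))) N
  sumL-parts F = trans (sumL-concatMap F (λ u → (suc u , false) ∷ (suc u , true) ∷ []) (upTo N))
                       (sumL-applyUpTo (λ u → sumFlags (λ o → F (suc u , o))) (λ u → u) N)

  tailSumOfLength : (List Part → ℤ) → ℕ → ℕ → ℕ → ℤ
  tailSumOfLength φ L v r = sumL (λ l → 𝕀 (isTailOf v r l) * φ l) (lists L)

  tailSumOfLength-suc : ∀ φ L v r → tailSumOfLength φ (suc L) v r ≡
    sumL (λ y → headFactor v r y * tailSumOfLength (λ l → φ (y ∷ l)) L (proj₁ y) (r ∸ proj₁ y)) parts
  tailSumOfLength-suc φ L v r =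
    trans (sumL-listsOfLength-suc (λ l → 𝕀 (isTailOf v r l) * φ l) L parts)
          (sumL-cong (λ y → trans (sumL-cong (split y) (lists L)) (sumL-*ˡ (headFactor v r y) _ (lists L))) parts)
    where
    split : ∀ y l → 𝕀 (isTailOf v r (y ∷ l)) * φ (y ∷ l) ≡
                    headFactor v r y * (𝕀 (isTailOf (proj₁ y) (r ∸ proj₁ y) l) * φ (y ∷ l))
    split y l =
      trans (cong (_* φ (y ∷ l)) (trans (𝕀-∧ (mayFollow v y) _)
                                        (cong (𝕀 (mayFollow v y) *_) (𝕀-isOverpartitionOf-∷ r y l))))
            (regroup (𝕀 (mayFollow v y)) (topFactor r y) _ (φ (y ∷ l)))
      where
      regroup : ∀ m t i f → m * (t * i) * f ≡ m * t * (i * f)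
      regroup = solve-∀

  -- every part is at least 1
  tailSumOfLength-vanish : ∀ φ L v r → r < L → tailSumOfLength φ L v r ≡ 0ℤ
  tailSumOfLength-vanish φ (suc L) v r (s≤s r≤L) =
    trans (tailSumOfLength-suc φ L v r) (sumL-0 _ (λ y → headFactor-guard v r y _ (shorter y)) parts)
    where
    shorter : ∀ y → 1 ≤ proj₁ y → proj₁ y ≤ r →
              tailSumOfLength (λ l → φ (y ∷ l)) L (proj₁ y) (r ∸ proj₁ y) ≡ 0ℤ
    shorter y 1≤w w≤r =
      tailSumOfLength-vanish _ L (proj₁ y) (r ∸ proj₁ y) (ℕₚ.<-≤-trans (ℕₚ.∸-monoʳ-< 1≤w w≤r) r≤L)

  tailSum : (List Part → ℤ) → ℕ → ℕ → ℤ
  tailSum φ v r = sumBelow (λ L → tailSumOfLength φ L v r) N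

  tailSum-rec : ∀ φ v r → r < N → tailSum φ v r ≡
    𝕀 (0 ≡ᵇ r) * φ [] + 0ℤ +
    sumL (λ y → headFactor v r y * tailSum (λ l → φ (y ∷ l)) (proj₁ y) (r ∸ proj₁ y)) parts
  tailSum-rec φ v r r<N = begin
    sumBelow t N
      ≡⟨ sym dropLast ⟩
    t 0 + sumBelow (λ L → t (suc L)) N
      ≡⟨ cong (_+_ (t 0)) (sumBelow-cong N (λ L _ → tailSumOfLength-suc φ L v r)) ⟩
    t 0 + sumBelow (λ L → sumL (λ y → headFactor v r y * t′ y L) parts) N
      ≡⟨ cong (_+_ (t 0)) (sumBelow-sumL _ parts N) ⟩
    t 0 + sumL (λ y → sumBelow (λ L → headFactor v r y * t′ y L) N) parts
      ≡⟨ cong (_+_ (t 0)) (sumL-cong (λ y → sumBelow-*ˡ (headFactor v r y) (t′ y) N) parts) ⟩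
    t 0 + sumL (λ y → headFactor v r y * sumBelow (t′ y) N) parts ∎
    where
    open ≡-Reasoning
    t : ℕ → ℤ
    t L = tailSumOfLength φ L v r
    t′ : Part → ℕ → ℤ
    t′ y L = tailSumOfLength (λ l → φ (y ∷ l)) L (proj₁ y) (r ∸ proj₁ y)
    dropLast : t 0 + sumBelow (λ L → t (suc L)) N ≡ sumBelow t N
    dropLast = trans (sumBelow-suc t N)
                     (trans (cong (_+_ (sumBelow t N)) (tailSumOfLength-vanish φ N v r r<N))
                            (ℤₚ.+-identityʳ _))

  sumL-overpartitions : ∀ (φ : List Part → ℤ) →
    sumL (λ l → 𝕀 (isOverpartitionOf N l) * φ l) (candidates N) ≡
    𝕀 (0 ≡ᵇ N) * φ [] + 0ℤ +
    sumL (λ y → topFactor N y * tailSum (λ l → φ (y ∷ l)) (proj₁ y) (N ∸ proj₁ y)) parts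
  sumL-overpartitions φ = begin
    sumL F (candidates N)
      ≡⟨ byLength ⟩
    sumL F (lists 0) + sumBelow (λ L → sumL F (lists (suc L))) N
      ≡⟨ cong (_+_ (sumL F (lists 0))) (sumBelow-cong N (λ L _ → byHead L)) ⟩
    sumL F (lists 0) + sumBelow (λ L → sumL (λ y → topFactor N y * t′ y L) parts) N
      ≡⟨ cong (_+_ (sumL F (lists 0))) (sumBelow-sumL _ parts N) ⟩
    sumL F (lists 0) + sumL (λ y → sumBelow (λ L → topFactor N y * t′ y L) N) parts
      ≡⟨ cong (_+_ (sumL F (lists 0))) (sumL-cong (λ y → sumBelow-*ˡ (topFactor N y) (t′ y) N) parts) ⟩
    sumL F (lists 0) + sumL (λ y → topFactor N y * sumBelow (t′ y) N) parts ∎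
    where
    open ≡-Reasoning
    F : List Part → ℤ
    F l = 𝕀 (isOverpartitionOf N l) * φ l
    t′ : Part → ℕ → ℤ
    t′ y L = tailSumOfLength (λ l → φ (y ∷ l)) L (proj₁ y) (N ∸ proj₁ y)
    byLength : sumL F (candidates N) ≡ sumL F (lists 0) + sumBelow (λ L → sumL F (lists (suc L))) N
    byLength = trans (sumL-concatMap F lists (upTo (suc N)))
                     (sumL-applyUpTo (λ L → sumL F (lists L)) (λ L → L) (suc N))
    byHead : ∀ L → sumL F (lists (suc L)) ≡ sumL (λ y → topFactor N y * t′ y L) parts
    byHead L = trans (sumL-listsOfLength-suc F L parts) (sumL-cong (λ y →
      trans (sumL-cong (λ l → trans (cong (_* φ (y ∷ l)) (𝕀-isOverpartitionOf-∷ N y l))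
                                    (ℤₚ.*-assoc (topFactor N y) _ _)) (lists L))
            (sumL-*ˡ (topFactor N y) _ (lists L))) parts)

  tailCount tailWeight : ℕ → ℕ → ℤ
  tailCount  = tailSum (λ _ → 1ℤ)
  tailWeight = tailSum (λ l → + novParts k l)

  tailSum-affine : ∀ {ψ : List Part → ℤ} a φ → (∀ l → ψ l ≡ a + φ l) →
                   ∀ v r → tailSum ψ v r ≡ a * tailCount v r + tailSum φ v r
  tailSum-affine {ψ} a φ ψ≗a+φ v r =
    trans (sumBelow-cong N (λ L _ → trans (sumL-cong split (lists L))
                                    (trans (sumL-+ (λ l → a * (𝕀 (isTailOf v r l) * 1ℤ)) _ (lists L))
                                           (cong (_+ tailSumOfLength φ L v r) (sumL-*ˡ a _ (lists L))))))
    (trans (sumBelow-+ (λ L → a * count L) (λ L → tailSumOfLength φ L v r) N)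
           (cong (_+ tailSum φ v r) (sumBelow-*ˡ a count N)))
    where
    count : ℕ → ℤ
    count L = tailSumOfLength (λ _ → 1ℤ) L v r
    split : ∀ l → 𝕀 (isTailOf v r l) * ψ l ≡ a * (𝕀 (isTailOf v r l) * 1ℤ) + 𝕀 (isTailOf v r l) * φ l
    split l = trans (cong (𝕀 (isTailOf v r l) *_) (ψ≗a+φ l)) (expand (𝕀 (isTailOf v r l)) a (φ l))
      where
      expand : ∀ i a f → i * (a + f) ≡ a * (i * 1ℤ) + i * f
      expand = solve-∀

  tailSum-novParts-∷ : ∀ y v r → tailSum (λ l → + novParts k (y ∷ l)) v r ≡
                                 partValue k y * tailCount v r + tailWeight v r
  tailSum-novParts-∷ (w , o) =
    tailSum-affine (partValue k (w , o)) (λ l → + novParts k l) (λ l → ℤₚ.pos-+ _ (novParts k l))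

  tailCount-rec : ∀ m r → r < N → tailCount (suc m) r ≡
    𝕀 (0 ≡ᵇ r) * 1ℤ + 0ℤ + sumBelow (λ u → headWeight m r u * tailCount (suc u) (r ∸ suc u)) N
  tailCount-rec m r r<N =
    trans (tailSum-rec (λ _ → 1ℤ) (suc m) r r<N)
          (cong (_+_ (𝕀 (0 ≡ᵇ r) * 1ℤ + 0ℤ))
                (trans (sumL-parts _) (sumBelow-cong N (λ u _ →
                   sumFlags-*ʳ (λ o → headFactor (suc m) r (suc u , o)) (tailCount (suc u) (r ∸ suc u))))))

  tailWeight-rec : ∀ m r → r < N → tailWeight (suc m) r ≡
    𝕀 (0 ≡ᵇ r) * + 0 + 0ℤ
      + sumBelow (λ u → sumFlags (λ o → headFactor (suc m) r (suc u , o) *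
                                        (partValue k (suc u , o) * tailCount (suc u) (r ∸ suc u)))) N
      + sumBelow (λ u → headWeight m r u * tailWeight (suc u) (r ∸ suc u)) N
  tailWeight-rec m r r<N = begin
    tailWeight (suc m) r
      ≡⟨ tailSum-rec (λ l → + novParts k l) (suc m) r r<N ⟩
    z + sumL (λ y → headFactor (suc m) r y * tailSum (λ l → + novParts k (y ∷ l)) (proj₁ y) (r ∸ proj₁ y)) parts
      ≡⟨ cong (_+_ z) (trans (sumL-parts _) (sumBelow-cong N (λ u _ → split u))) ⟩
    z + sumBelow (λ u → byValue u + recursive u) N
      ≡⟨ trans (cong (_+_ z) (sumBelow-+ byValue recursive N)) (sym (ℤₚ.+-assoc z _ _)) ⟩
    z + sumBelow byValue N + sumBelow recursive N ∎
    where
    open ≡-Reasoning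
    z = 𝕀 (0 ≡ᵇ r) * + 0 + 0ℤ
    h : Bool → ℕ → ℤ
    h o u = headFactor (suc m) r (suc u , o)
    recursive byValue : ℕ → ℤ
    recursive u = headWeight m r u * tailWeight (suc u) (r ∸ suc u)
    byValue u = sumFlags (λ o → h o u * (partValue k (suc u , o) * tailCount (suc u) (r ∸ suc u)))
    expand : ∀ h₀ h₁ p₀ p₁ c w → h₀ * (p₀ * c + w) + (h₁ * (p₁ * c + w) + 0ℤ) ≡
                                  (h₀ * (p₀ * c) + (h₁ * (p₁ * c) + 0ℤ)) + (h₀ + (h₁ + 0ℤ)) * w
    expand = solve-∀
    split : ∀ u → sumFlags (λ o → h o u * tailSum (λ l → + novParts k ((suc u , o) ∷ l)) (suc u) (r ∸ suc u)) ≡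
                  byValue u + recursive u
    split u =
      trans (cong₂ (λ x y → h false u * x + (h true u * y + 0ℤ))
                   (tailSum-novParts-∷ (suc u , false) (suc u) (r ∸ suc u))
                   (tailSum-novParts-∷ (suc u , true) (suc u) (r ∸ suc u)))
            (expand (h false u) (h true u) (partValue k (suc u , false)) (partValue k (suc u , true))
                    (tailCount (suc u) (r ∸ suc u)) (tailWeight (suc u) (r ∸ suc u)))

module LargestPartRecursion (N : ℕ) (κ : ℕ → ℕ → ℕ → ℤ) (κ-vanish : ∀ m r u → r ≤ u → κ m r u ≡ 0ℤ)
  where

  Solves : (ℕ → ℕ → ℤ) → (ℕ → ℕ → ℤ) → Set
  Solves β F = ∀ m r → m < N → r < N → F m r ≡ β m r + sumBelow (λ u → κ m r u * F u (r ∸ suc u)) N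

  solution-unique : ∀ {β F G} → Solves β F → Solves β G → ∀ m r → m < N → r < N → F m r ≡ G m r
  solution-unique {β} {F} {G} F-solves G-solves m r = agree (suc r) r ℕₚ.≤-refl m
    where
    agree : ∀ b r → r < b → ∀ m → m < N → r < N → F m r ≡ G m r
    agree (suc b) r (s≤s r≤b) m m<N r<N =
      trans (F-solves m r m<N r<N)
      (trans (cong (_+_ (β m r)) (sumBelow-cong N summand)) (sym (G-solves m r m<N r<N)))
      where
      summand : ∀ u → u < N → κ m r u * F u (r ∸ suc u) ≡ κ m r u * G u (r ∸ suc u)
      summand u u<N with suc u ℕ.≤? r
      ... | yes u<r = cong (κ m r u *_) (agree b (r ∸ suc u) smaller u u<N (ℕₚ.≤-<-trans (ℕₚ.m∸n≤m r (suc u)) r<N))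
        where
        smaller : r ∸ suc u < b
        smaller = ℕₚ.<-≤-trans (ℕₚ.∸-monoʳ-< (s≤s z≤n) u<r) r≤b
      ... | no u≮r = trans (killed F) (sym (killed G))
        where
        killed : ∀ H → κ m r u * H u (r ∸ suc u) ≡ 0ℤ
        killed H = trans (cong (_* H u (r ∸ suc u)) (κ-vanish m r u (ℕₚ.≤-pred (ℕₚ.≰⇒> u≮r))))
                         (ℤₚ.*-zeroˡ (H u (r ∸ suc u)))

-- Closed forms of the tail sums

-- R m = ∏_(j ≤ m) (1 + q^j)/(1 - q^j) generates the overpartitions with parts at most m.  C m and W k m
-- generate the number and the nov-weight of the overpartitions that may follow a part m + 1:
-- C m = R m/(1 - q^(m+1)) and W k m = C m · Σ_(u ≤ m+1, k ∣ u) u q^u/(1 - q^u) = C m · K k (m + 1).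
C : ℕ → ℤ⟦q⟧
C m = R m ⊛ γ (suc m)

divisorPart : ℕ → ℕ → ℤ
divisorPart k w = partValue k (w , false)

K : ℕ → ℕ → ℤ⟦q⟧
K k zero    = 𝟘
K k (suc m) = K k m ⊕ const (divisorPart k (suc m)) ⊛ (q^ (suc m) ⊛ γ (suc m))

W : ℕ → ℕ → ℤ⟦q⟧
W k m = C m ⊛ K k (suc m)

γ-unfold : ∀ d′ → γ (suc d′) ≋ 𝟙 ⊕ q^ (suc d′) ⊛ γ (suc d′)
γ-unfold d′ =
  ≋-trans (solve 2 (λ x g → g := (con 1ℤ :+ con (- 1ℤ) :* x) :* g :+ x :* g) (λ _ → refl) x (γ d))
          (λ n → cong (_+ (x ⊛ γ d) n) (𝟙⊖q^-⊛-γ d′ n))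
  where
  d = suc d′
  x = q^ d

C-unfold : ∀ m → C m ≋ R m ⊕ q^ (suc m) ⊛ C m
C-unfold m =
  ≋-trans (⊛-cong {R m} (λ _ → refl) (γ-unfold m))
          (solve 3 (λ r x g → r :* (con 1ℤ :+ x :* g) := r :+ x :* (r :* g))
                   (λ _ → refl) (R m) (q^ suc m) (γ (suc m)))

R-suc : ∀ m → R (suc m) ≋ R m ⊕ const (+ 2) ⊛ (q^ (suc m) ⊛ C m)
R-suc m n = begin
  R (suc m) n
    ≡⟨ solve 3 (λ r x g → r :* ((con 1ℤ :+ con 1ℤ :* x) :* g) := r :* g :+ x :* (r :* g))
               (λ _ → refl) (R m) x (γ (suc m)) n ⟩
  (C m ⊕ x ⊛ C m) n
    ≡⟨ cong (_+ (x ⊛ C m) n) (C-unfold m n) ⟩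
  (R m ⊕ x ⊛ C m ⊕ x ⊛ C m) n
    ≡⟨ solve 3 (λ r x c → r :+ x :* c :+ x :* c := r :+ con (+ 2) :* (x :* c)) (λ _ → refl) (R m) x (C m) n ⟩
  (R m ⊕ const (+ 2) ⊛ (x ⊛ C m)) n ∎
  where
  open ≡-Reasoning
  x = q^ suc m

R-expansion : ∀ m r → R m r ≡ 𝟙 r + sumBelow (λ u → (const (+ 2) ⊛ (q^ (suc u) ⊛ C u)) r) m
R-expansion zero    r = sym (ℤₚ.+-identityʳ (𝟙 r))
R-expansion (suc m) r =
  trans (R-suc m r)
  (trans (cong (_+ term m) (R-expansion m r))
  (trans (ℤₚ.+-assoc (𝟙 r) (sumBelow term m) (term m)) (cong (_+_ (𝟙 r)) (sym (sumBelow-suc term m)))))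
  where
  term : ℕ → ℤ
  term u = (const (+ 2) ⊛ (q^ (suc u) ⊛ C u)) r

module _ (k : ℕ) where

  private
    a : ℕ → ℤ⟦q⟧
    a u = const (divisorPart k (suc u))

  W-unfold : ∀ m → W k m ≋ q^ (suc m) ⊛ (a m ⊛ C m ⊕ W k m) ⊕ R m ⊛ K k m
  W-unfold m =
    ≋-trans (⊛-cong (C-unfold m) (λ _ → refl))
            (solve 5 (λ r x g κ α → (r :+ x :* (r :* g)) :* (κ :+ α :* (x :* g)) :=
                                     x :* (α :* (r :* g) :+ (r :* g) :* (κ :+ α :* (x :* g))) :+ r :* κ)
                     (λ _ → refl) (R m) (q^ suc m) (γ (suc m)) (K k m) (a m))

  RK-suc : ∀ m → R (suc m) ⊛ K k (suc m) ≋
                 R m ⊛ K k m ⊕ q^ (suc m) ⊛ (a m ⊛ C m ⊕ const (+ 2) ⊛ W k m)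
  RK-suc m =
    ≋-trans (⊛-cong (R-suc m) (λ _ → refl))
            (solve 5 (λ r x g κ α → (r :+ con (+ 2) :* (x :* (r :* g))) :* (κ :+ α :* (x :* g)) :=
                                     r :* κ :+ x :* (α :* (r :* g) :+ con (+ 2) :* ((r :* g) :* (κ :+ α :* (x :* g)))))
                     (λ _ → refl) (R m) (q^ suc m) (γ (suc m)) (K k m) (a m))

  RK-expansion : ∀ m r → (R m ⊛ K k m) r ≡
                         sumBelow (λ u → (q^ (suc u) ⊛ (a u ⊛ C u ⊕ const (+ 2) ⊛ W k u)) r) m
  RK-expansion zero    r = trans (⊛-zeroʳ 𝟙 r) (𝟘≗0 r)
  RK-expansion (suc m) r =
    trans (RK-suc m r) (trans (cong (_+ term m) (RK-expansion m r)) (sym (sumBelow-suc term m)))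
    where
    term : ℕ → ℤ
    term u = (q^ (suc u) ⊛ (a u ⊛ C u ⊕ const (+ 2) ⊛ W k u)) r

-- Parts u + 1 < m + 1 may follow m + 1 with either flag, m + 1 itself only non-overlined.
sumBelow-mayFollow : ∀ N m (h : Bool → ℕ → ℤ) → m < N →
  sumBelow (λ u → sumFlags (λ o → 𝕀 (mayFollow (suc m) (suc u , o)) * h o u)) N ≡
  sumBelow (λ u → sumFlags (λ o → h o u)) m + h false m
sumBelow-mayFollow N m h m<N =
  trans (sumBelow-extend g (suc m) N m<N beyond)
  (trans (sumBelow-suc g m) (cong₂ _+_ (sumBelow-cong m below) at))
  where
  g : ℕ → ℤ
  g u = sumFlags (λ o → 𝕀 (mayFollow (suc m) (suc u , o)) * h o u)
  flags : ∀ u (b₀ b₁ : Bool) → mayFollow (suc m) (suc u , false) ≡ b₀ → mayFollow (suc m) (suc u , true) ≡ b₁ →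
          g u ≡ 𝕀 b₀ * h false u + (𝕀 b₁ * h true u + 0ℤ)
  flags u b₀ b₁ e₀ e₁ = cong₂ (λ x y → 𝕀 x * h false u + (𝕀 y * h true u + 0ℤ)) e₀ e₁
  beyond : ∀ u → suc m ≤ u → u < N → g u ≡ 0ℤ
  beyond u m<u _ = flags u false false (mayFollow-> false m<u) (mayFollow-> true m<u)
  below : ∀ u → u < m → g u ≡ sumFlags (λ o → h o u)
  below u u<m = trans (flags u true true (mayFollow-< false u<m) (mayFollow-< true u<m))
                      (cong₂ (λ x y → x + (y + 0ℤ)) (ℤₚ.*-identityˡ (h false u)) (ℤₚ.*-identityˡ (h true u)))
  at : g m ≡ h false m
  at = trans (flags m true false (mayFollow-≡ m false) (mayFollow-≡ m true))
             (trans (ℤₚ.+-identityʳ _) (ℤₚ.*-identityˡ (h false m)))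

headFactor-suc : ∀ m r u o x →
  headFactor (suc m) r (suc u , o) * x ≡ 𝕀 (mayFollow (suc m) (suc u , o)) * (𝕀 (suc u ≤ᵇ r) * x)
headFactor-suc m r u o x = regroup (𝕀 (mayFollow (suc m) (suc u , o))) (𝕀 (suc u ≤ᵇ r)) x
  where
  regroup : ∀ f l x → f * (1ℤ * l) * x ≡ f * (l * x)
  regroup = solve-∀

sumBelow-headWeight : ∀ N m r (F : ℕ → ℤ⟦q⟧) → m < N →
  sumBelow (λ u → headWeight m r u * F u (r ∸ suc u)) N ≡
  sumBelow (λ u → (const (+ 2) ⊛ (q^ (suc u) ⊛ F u)) r) m + (q^ (suc m) ⊛ F m) r
sumBelow-headWeight N m r F m<N =
  trans (sumBelow-cong N (λ u _ → trans (sym (sumFlags-*ʳ (λ o → headFactor (suc m) r (suc u , o)) (F u (r ∸ suc u))))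
                                        (cong₂ (λ x y → x + (y + 0ℤ)) (shifted u false) (shifted u true))))
  (trans (sumBelow-mayFollow N m (λ _ u → (q^ (suc u) ⊛ F u) r) m<N)
         (cong (_+ (q^ (suc m) ⊛ F m) r) (sumBelow-cong m (λ u _ → doubled u))))
  where
  shifted : ∀ u o → headFactor (suc m) r (suc u , o) * F u (r ∸ suc u) ≡
                    𝕀 (mayFollow (suc m) (suc u , o)) * (q^ (suc u) ⊛ F u) r
  shifted u o = trans (headFactor-suc m r u o _)
                      (cong (𝕀 (mayFollow (suc m) (suc u , o)) *_) (sym (q^-⊛ (suc u) (F u) r)))
  doubled : ∀ u → sumFlags (λ _ → (q^ (suc u) ⊛ F u) r) ≡ (const (+ 2) ⊛ (q^ (suc u) ⊛ F u)) r
  doubled u = trans (twice _) (sym (const-⊛ (+ 2) _ r))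
    where
    twice : ∀ x → x + (x + 0ℤ) ≡ + 2 * x
    twice = solve-∀

sumBelow-headValue : ∀ k N m r (F : ℕ → ℤ⟦q⟧) → m < N → let a = λ u → const (divisorPart k (suc u)) in
  sumBelow (λ u → sumFlags (λ o → headFactor (suc m) r (suc u , o) * (partValue k (suc u , o) * F u (r ∸ suc u)))) N ≡
  sumBelow (λ u → (q^ (suc u) ⊛ (a u ⊛ F u)) r) m + (q^ (suc m) ⊛ (a m ⊛ F m)) r
sumBelow-headValue k N m r F m<N =
  trans (sumBelow-cong N (λ u _ → cong₂ (λ x y → x + (y + 0ℤ)) (shifted u false) (shifted u true)))
  (trans (sumBelow-mayFollow N m (λ o u → partValue k (suc u , o) * fits u) m<N)
         (cong₂ _+_ (sumBelow-cong m (λ u _ → trans (ℤₚ.+-identityʳ _) (scaled u))) (scaled m)))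
  where
  fits : ℕ → ℤ
  fits u = 𝕀 (suc u ≤ᵇ r) * F u (r ∸ suc u)
  swap : ∀ a b x → a * (b * x) ≡ b * (a * x)
  swap = solve-∀
  shifted : ∀ u o → headFactor (suc m) r (suc u , o) * (partValue k (suc u , o) * F u (r ∸ suc u)) ≡
                    𝕀 (mayFollow (suc m) (suc u , o)) * (partValue k (suc u , o) * fits u)
  shifted u o = trans (headFactor-suc m r u o _)
                      (cong (𝕀 (mayFollow (suc m) (suc u , o)) *_)
                            (swap (𝕀 (suc u ≤ᵇ r)) (partValue k (suc u , o)) (F u (r ∸ suc u))))
  scaled : ∀ u → divisorPart k (suc u) * fits u ≡ (q^ (suc u) ⊛ (const (divisorPart k (suc u)) ⊛ F u)) r
  scaled u = trans (swap (divisorPart k (suc u)) (𝕀 (suc u ≤ᵇ r)) (F u (r ∸ suc u)))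
    (sym (trans (q^-⊛ (suc u) _ r) (cong (𝕀 (suc u ≤ᵇ r) *_) (const-⊛ (divisorPart k (suc u)) (F u) (r ∸ suc u)))))

module _ (N : ℕ) where

  open LargestPartRecursion N headWeight headWeight-vanish

  C-solves : Solves (λ _ r → 𝕀 (0 ≡ᵇ r) * 1ℤ + 0ℤ) C
  C-solves m r m<N _ = begin
    C m r
      ≡⟨ C-unfold m r ⟩
    R m r + last
      ≡⟨ cong (_+ last) (R-expansion m r) ⟩
    𝟙 r + sumBelow doubled m + last
      ≡⟨ ℤₚ.+-assoc (𝟙 r) _ _ ⟩
    𝟙 r + (sumBelow doubled m + last)
      ≡⟨ cong₂ _+_ (trans (𝟙≗𝕀 r) (sym (ℤₚ.+-identityʳ _))) (sym (sumBelow-headWeight N m r C m<N)) ⟩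
    𝕀 (0 ≡ᵇ r) * 1ℤ + 0ℤ + sumBelow (λ u → headWeight m r u * C u (r ∸ suc u)) N ∎
    where
    open ≡-Reasoning
    last = (q^ (suc m) ⊛ C m) r
    doubled : ℕ → ℤ
    doubled u = (const (+ 2) ⊛ (q^ (suc u) ⊛ C u)) r

  module _ (k : ℕ) where

    partValueSum : ℕ → ℕ → ℤ
    partValueSum m r = 𝕀 (0 ≡ᵇ r) * + 0 + 0ℤ
      + sumBelow (λ u → sumFlags (λ o → headFactor (suc m) r (suc u , o) *
                                        (partValue k (suc u , o) * C u (r ∸ suc u)))) N

    W-solves : Solves partValueSum (W k)
    W-solves m r m<N _ = begin
      W k m r
        ≡⟨ W-unfold k m r ⟩
      (q^ (suc m) ⊛ (a m ⊛ C m ⊕ W k m)) r + (R m ⊛ K k m) r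
        ≡⟨ cong₂ _+_ (⊛-distribˡ (q^ (suc m)) (a m ⊛ C m) (W k m) r)
                     (trans (RK-expansion k m r) (sumBelow-cong m (λ u _ → split u))) ⟩
      byValue m + recursive m + sumBelow (λ u → byValue u + doubled u) m
        ≡⟨ cong (_+_ (byValue m + recursive m)) (sumBelow-+ byValue doubled m) ⟩
      byValue m + recursive m + (sumBelow byValue m + sumBelow doubled m)
        ≡⟨ rearrange (byValue m) (recursive m) (sumBelow byValue m) (sumBelow doubled m) (𝕀 (0 ≡ᵇ r)) ⟩
      𝕀 (0 ≡ᵇ r) * + 0 + 0ℤ + (sumBelow byValue m + byValue m) + (sumBelow doubled m + recursive m)
        ≡⟨ cong₂ (λ x y → 𝕀 (0 ≡ᵇ r) * + 0 + 0ℤ + x + y) (sym (sumBelow-headValue k N m r C m<N))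
                                                        (sym (sumBelow-headWeight N m r (W k) m<N)) ⟩
      partValueSum m r + sumBelow (λ u → headWeight m r u * W k u (r ∸ suc u)) N ∎
      where
      open ≡-Reasoning
      a : ℕ → ℤ⟦q⟧
      a u = const (divisorPart k (suc u))
      byValue recursive doubled : ℕ → ℤ
      byValue u = (q^ (suc u) ⊛ (a u ⊛ C u)) r
      recursive u = (q^ (suc u) ⊛ W k u) r
      doubled u = (const (+ 2) ⊛ (q^ (suc u) ⊛ W k u)) r
      split : ∀ u → (q^ (suc u) ⊛ (a u ⊛ C u ⊕ const (+ 2) ⊛ W k u)) r ≡ byValue u + doubled u
      split u = trans (⊛-distribˡ (q^ (suc u)) (a u ⊛ C u) (const (+ 2) ⊛ W k u) r)
                      (cong (_+_ (byValue u)) (solve 2 (λ x w → x :* (con (+ 2) :* w) := con (+ 2) :* (x :* w))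
                                                       (λ _ → refl) (q^ (suc u)) (W k u) r))
      rearrange : ∀ a b c d i → a + b + (c + d) ≡ i * + 0 + 0ℤ + (c + a) + (d + b)
      rearrange = solve-∀

module _ (k N : ℕ) where

  open Enumeration k N
  open LargestPartRecursion N headWeight headWeight-vanish

  tailCount≡C : ∀ m r → m < N → r < N → tailCount (suc m) r ≡ C m r
  tailCount≡C = solution-unique {λ _ r → 𝕀 (0 ≡ᵇ r) * 1ℤ + 0ℤ} {λ m r → tailCount (suc m) r} {C}
                                (λ m r _ r<N → tailCount-rec m r r<N) (C-solves N)

  tailWeight≡W : ∀ m r → m < N → r < N → tailWeight (suc m) r ≡ W k m r
  tailWeight≡W = solution-unique {partValueSum N k} {λ m r → tailWeight (suc m) r} {W k}
                                 tailWeight-solves (W-solves N k)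
    where
    tailWeight-solves : Solves (partValueSum N k) (λ m r → tailWeight (suc m) r)
    tailWeight-solves m r m<N r<N =
      trans (tailWeight-rec m r r<N)
            (cong (λ x → 𝕀 (0 ≡ᵇ r) * + 0 + 0ℤ + x + sumBelow (λ u → headWeight m r u * tailWeight (suc u) (r ∸ suc u)) N)
                  (sumBelow-cong N (λ u u<N → cong (λ x → sumFlags (λ o → headFactor (suc m) r (suc u , o) *
                                                                           (partValue k (suc u , o) * x)))
                                                   (tailCount≡C u (r ∸ suc u) u<N
                                                                (ℕₚ.≤-<-trans (ℕₚ.m∸n≤m r (suc u)) r<N)))))

  largestPart : ∀ u → u < N →
    sumFlags (λ o → topFactor N (suc u , o) * tailSum (λ l → + novParts k ((suc u , o) ∷ l)) (suc u) (N ∸ suc u)) ≡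
    (q^ (suc u) ⊛ (const (divisorPart k (suc u)) ⊛ C u ⊕ const (+ 2) ⊛ W k u)) N
  largestPart u u<N = begin
    sumFlags (λ o → fits * tailSum (λ l → + novParts k ((suc u , o) ∷ l)) (suc u) (N ∸ suc u))
      ≡⟨ cong₂ (λ x y → fits * x + (fits * y + 0ℤ)) (tailSum-novParts-∷ (suc u , false) (suc u) (N ∸ suc u))
                                                    (tailSum-novParts-∷ (suc u , true) (suc u) (N ∸ suc u)) ⟩
    sumFlags (λ o → fits * (partValue k (suc u , o) * tailCount (suc u) r + tailWeight (suc u) r))
      ≡⟨ cong₂ (λ c w → sumFlags (λ o → fits * (partValue k (suc u , o) * c + w)))
               (tailCount≡C u r u<N r<N) (tailWeight≡W u r u<N r<N) ⟩
    sumFlags (λ o → fits * (partValue k (suc u , o) * C u r + W k u r))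
      ≡⟨ collect (𝕀 (suc u ≤ᵇ N)) (divisorPart k (suc u)) (C u r) (W k u r) ⟩
    𝕀 (suc u ≤ᵇ N) * (divisorPart k (suc u) * C u r + + 2 * W k u r)
      ≡⟨ cong (𝕀 (suc u ≤ᵇ N) *_) (sym (cong₂ _+_ (const-⊛ (divisorPart k (suc u)) (C u) r)
                                                  (const-⊛ (+ 2) (W k u) r))) ⟩
    𝕀 (suc u ≤ᵇ N) * (const (divisorPart k (suc u)) ⊛ C u ⊕ const (+ 2) ⊛ W k u) r
      ≡⟨ sym (q^-⊛ (suc u) _ N) ⟩
    (q^ (suc u) ⊛ (const (divisorPart k (suc u)) ⊛ C u ⊕ const (+ 2) ⊛ W k u)) N ∎
    where
    open ≡-Reasoning
    r = N ∸ suc u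
    fits = 1ℤ * 𝕀 (suc u ≤ᵇ N)
    r<N : r < N
    r<N = ℕₚ.∸-monoʳ-< (s≤s z≤n) u<N
    collect : ∀ t p c w → 1ℤ * t * (p * c + w) + (1ℤ * t * (+ 0 * c + w) + 0ℤ) ≡ t * (p * c + + 2 * w)
    collect = solve-∀

  nov≡R⊛K : + nov k N ≡ (R N ⊛ K k N) N
  nov≡R⊛K = begin
    + nov k N
      ≡⟨ sumℕ-filterᵇ (isOverpartitionOf N) (novParts k) (candidates N) ⟩
    sumL (λ l → 𝕀 (isOverpartitionOf N l) * + novParts k l) (candidates N)
      ≡⟨ sumL-overpartitions (λ l → + novParts k l) ⟩
    𝕀 (0 ≡ᵇ N) * + 0 + 0ℤ +
    sumL (λ y → topFactor N y * tailSum (λ l → + novParts k (y ∷ l)) (proj₁ y) (N ∸ proj₁ y)) parts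
      ≡⟨ cong₂ _+_ (cong (_+ 0ℤ) (ℤₚ.*-zeroʳ (𝕀 (0 ≡ᵇ N))))
                   (trans (sumL-parts _) (sumBelow-cong N largestPart)) ⟩
    0ℤ + sumBelow (λ u → (q^ (suc u) ⊛ (const (divisorPart k (suc u)) ⊛ C u ⊕ const (+ 2) ⊛ W k u)) N) N
      ≡⟨ trans (ℤₚ.+-identityˡ _) (sym (RK-expansion k N N)) ⟩
    (R N ⊛ K k N) N ∎
    where open ≡-Reasoning

-- Divisor sums

geomSeries-below : ∀ v d′ m N → m ≤ N →
  geomSeries v (suc d′) m ≡ 𝕀 (0 ≡ᵇ m) * v 0 + sumBelow (λ a → 𝕀 (suc a ℕ.* suc d′ ≡ᵇ m) * v (suc a)) N
geomSeries-below v d′ m N m≤N = cong (_+_ (𝕀 (0 ≡ᵇ m) * v 0)) (sym (sumBelow-extend _ m N m≤N beyond))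
  where
  beyond : ∀ a → m ≤ a → a < N → 𝕀 (suc a ℕ.* suc d′ ≡ᵇ m) * v (suc a) ≡ 0ℤ
  beyond a m≤a _ =
    trans (cong (_* v (suc a)) (𝕀-≢ᵇ (λ eq → ℕₚ.<⇒≱ (s≤s m≤a) (subst (suc a ≤_) eq (ℕₚ.m≤m*n (suc a) d)))))
          (ℤₚ.*-zeroˡ (v (suc a)))
    where
    d = suc d′

q^⊛γ-below : ∀ d′ m N → m ≤ N →
  (q^ (suc d′) ⊛ γ (suc d′)) m ≡ sumBelow (λ b → 𝕀 (suc b ℕ.* suc d′ ≡ᵇ m) * 1ℤ) N
q^⊛γ-below d′ m N m≤N =
  cancel (𝟙 m) _ _ (trans (sym (γ-unfold d′ m))
                          (trans (geomSeries-below (λ _ → 1ℤ) d′ m N m≤N) (cong (_+ S) (sym (𝟙≗𝕀 m)))))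
  where
  S = sumBelow (λ b → 𝕀 (suc b ℕ.* suc d′ ≡ᵇ m) * 1ℤ) N
  cancel : ∀ x y z → x + y ≡ x + z → y ≡ z
  cancel x y z eq = trans (sym (undo x y)) (trans (cong (_+_ (- x)) eq) (undo x z))
    where
    undo : ∀ x y → - x + (x + y) ≡ y
    undo = solve-∀

K-pointwise : ∀ k N m → K k N m ≡ sumBelow (λ u → divisorPart k (suc u) * (q^ (suc u) ⊛ γ (suc u)) m) N
K-pointwise k zero    m = 𝟘≗0 m
K-pointwise k (suc N) m =
  trans (cong₂ _+_ (K-pointwise k N m) (const-⊛ (divisorPart k (suc N)) (q^ (suc N) ⊛ γ (suc N)) m))
        (sym (sumBelow-suc (λ u → divisorPart k (suc u) * (q^ (suc u) ⊛ γ (suc u)) m) N))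

crankSum-pointwise : ∀ k N m → crankSum k N m ≡ sumBelow (λ b → τ (k ℕ.* suc b) m) N
crankSum-pointwise k zero    m = 𝟘≗0 m
crankSum-pointwise k (suc N) m =
  trans (cong (_+ τ (k ℕ.* suc N) m) (crankSum-pointwise k N m)) (sym (sumBelow-suc (λ b → τ (k ℕ.* suc b) m) N))

if-∣ : ∀ {A : Set} k n (x y : A) → k ∣ n → (if does (k ∣? n) then x else y) ≡ x
if-∣ k n x y k∣n with k ∣? n
... | yes _   = refl
... | no k∤n = ⊥-elim (k∤n k∣n)

if-∤ : ∀ {A : Set} k n (x y : A) → ¬ k ∣ n → (if does (k ∣? n) then x else y) ≡ y
if-∤ k n x y k∤n with k ∣? n
... | yes k∣n = ⊥-elim (k∤n k∣n)
... | no _    = refl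

module _ (k′ : ℕ) where

  private
    k = suc k′

  divisorPart≡k*τ : ∀ d b m → m ≡ d ℕ.* suc b → divisorPart k d ≡ + k * τ (k ℕ.* suc b) m
  divisorPart≡k*τ d b m m≡de with k ∣? d
  ... | yes k∣d@(divides c d≡ck) =
    trans (cong +_ (trans (if-∣ k d d 0 k∣d) (trans d≡ck (ℕₚ.*-comm c k))))
    (trans (ℤₚ.pos-* k c)
           (cong (+ k *_) (sym (geomSeries-∣ {b ℕ.+ k′ ℕ.* suc b} (λ t → + t) m c
                                 (trans m≡de (trans (cong (ℕ._* suc b) d≡ck) (ℕₚ.*-assoc c k (suc b))))))))
  ... | no k∤d =
    trans (cong +_ (if-∤ k d d 0 k∤d))
    (sym (trans (cong (+ k *_) (geomSeries-∤ (k ℕ.* suc b) (λ t → + t) m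
                                  (λ ke∣m → k∤d (*-cancelʳ-∣ (suc b) (subst (k ℕ.* suc b ∣_) m≡de ke∣m)))))
                (ℤₚ.*-zeroʳ (+ k))))

  -- For fixed e = b + 1 only the divisor u + 1 = m / e contributes.
  sumBelow-divisorPart : ∀ b m N → m ≤ N →
    sumBelow (λ u → 𝕀 (suc b ℕ.* suc u ≡ᵇ m) * divisorPart k (suc u)) N ≡ + k * τ (k ℕ.* suc b) m
  sumBelow-divisorPart b m N m≤N with suc b ∣? m
  ... | no e∤m =
    trans (sumBelow-0 _ N (λ u _ → trans (cong (_* divisorPart k (suc u)) (𝕀-≢ᵇ (e∤m ∘ divides (suc u) ∘ flip u)))
                                         (ℤₚ.*-zeroˡ (divisorPart k (suc u)))))
          (sym (trans (cong (+ k *_) (geomSeries-∤ (k ℕ.* suc b) (λ t → + t) m (e∤m ∘ ∣-trans (n∣m*n k))))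
                      (ℤₚ.*-zeroʳ (+ k))))
    where
    flip : ∀ u → suc b ℕ.* suc u ≡ m → m ≡ suc u ℕ.* suc b
    flip u eq = trans (sym eq) (ℕₚ.*-comm (suc b) (suc u))
  ... | yes (divides zero m≡0) =
    trans (sumBelow-0 _ N (λ u _ → trans (cong (_* divisorPart k (suc u)) (𝕀-≢ᵇ (λ eq → ℕₚ.1+n≢0 (trans eq m≡0))))
                                         (ℤₚ.*-zeroˡ (divisorPart k (suc u)))))
          (sym (trans (cong (+ k *_) (geomSeries-∣ {b ℕ.+ k′ ℕ.* suc b} (λ t → + t) m 0 m≡0)) (ℤₚ.*-zeroʳ (+ k))))
  ... | yes (divides (suc d′) m≡de) =
    trans (sumBelow-single _ N d′ d′<N others)
          (trans (cong (_* divisorPart k d) (𝕀-≡ᵇ (trans (ℕₚ.*-comm e d) (sym m≡de))))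
                 (trans (ℤₚ.*-identityˡ _) (divisorPart≡k*τ d b m m≡de)))
    where
    d = suc d′
    e = suc b
    d′<N : d′ < N
    d′<N = ℕₚ.<-≤-trans (ℕₚ.n<1+n d′) (ℕₚ.≤-trans (subst (d ≤_) (sym m≡de) (ℕₚ.m≤m*n d e)) m≤N)
    others : ∀ u → u < N → u ≢ d′ → 𝕀 (e ℕ.* suc u ≡ᵇ m) * divisorPart k (suc u) ≡ 0ℤ
    others u _ u≢d′ =
      trans (cong (_* divisorPart k (suc u))
                  (𝕀-≢ᵇ (λ eq → u≢d′ (ℕₚ.suc-injective
                                       (ℕₚ.*-cancelʳ-≡ (suc u) d e (trans (ℕₚ.*-comm (suc u) e) (trans eq m≡de)))))))
            (ℤₚ.*-zeroˡ (divisorPart k (suc u)))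

  K≡k*crankSum : ∀ N m → m ≤ N → K k N m ≡ + k * crankSum k N m
  K≡k*crankSum N m m≤N = begin
    K k N m
      ≡⟨ K-pointwise k N m ⟩
    sumBelow (λ u → divisorPart k (suc u) * (q^ (suc u) ⊛ γ (suc u)) m) N
      ≡⟨ sumBelow-cong N (λ u _ → expand u) ⟩
    sumBelow (λ u → sumBelow (λ b → term b u) N) N
      ≡⟨ sumBelow-comm (λ u b → term b u) N N ⟩
    sumBelow (λ b → sumBelow (term b) N) N
      ≡⟨ sumBelow-cong N (λ b _ → sumBelow-divisorPart b m N m≤N) ⟩
    sumBelow (λ b → + k * τ (k ℕ.* suc b) m) N
      ≡⟨ sumBelow-*ˡ (+ k) (λ b → τ (k ℕ.* suc b) m) N ⟩
    + k * sumBelow (λ b → τ (k ℕ.* suc b) m) N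
      ≡⟨ cong (+ k *_) (sym (crankSum-pointwise k N m)) ⟩
    + k * crankSum k N m ∎
    where
    open ≡-Reasoning
    term : ℕ → ℕ → ℤ
    term b u = 𝕀 (suc b ℕ.* suc u ≡ᵇ m) * divisorPart k (suc u)
    expand : ∀ u → divisorPart k (suc u) * (q^ (suc u) ⊛ γ (suc u)) m ≡ sumBelow (λ b → term b u) N
    expand u =
      trans (cong (divisorPart k (suc u) *_) (q^⊛γ-below u m N m≤N))
      (trans (sym (sumBelow-*ˡ (divisorPart k (suc u)) (λ b → 𝕀 (suc b ℕ.* suc u ≡ᵇ m) * 1ℤ) N))
             (sumBelow-cong N (λ b _ → trans (cong (divisorPart k (suc u) *_) (ℤₚ.*-identityʳ _))
                                             (ℤₚ.*-comm (divisorPart k (suc u)) (𝕀 (suc b ℕ.* suc u ≡ᵇ m))))))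

mainTheorem2 : (k n : ℕ) → 1 ≤ k → + 2 * + nov k n ≡ + k * M2bar k n
mainTheorem2 (suc k′) n _ = begin
  + 2 * + nov k n                             ≡⟨ cong (+ 2 *_) (nov≡R⊛K k n) ⟩
  + 2 * (R n ⊛ K k n) n                       ≡⟨ cong (+ 2 *_) (⊛-cong-≤ (R n) n (K≡k*crankSum k′ n)) ⟩
  + 2 * (R n ⊛ scale (+ k) (crankSum k n)) n  ≡⟨ cong (+ 2 *_) (⊛-scaleʳ (+ k) (R n) (crankSum k n) n) ⟩
  + 2 * (+ k * (R n ⊛ crankSum k n) n)        ≡⟨ swap (+ 2) (+ k) _ ⟩
  + k * (+ 2 * (R n ⊛ crankSum k n) n)        ≡⟨ cong (+ k *_) (sym (M2bar≡2[R⊛crankSum] k′ n)) ⟩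
  + k * M2bar k n                             ∎
  where
  open ≡-Reasoning
  k = suc k′
  swap : ∀ a b x → a * (b * x) ≡ b * (a * x)
  swap = solve-∀
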